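{- $\mathsf{HS}_{\mathsf{st}}\not\geq\mathsf{HS}_{\mathsf{lin}}$ and $\mathsf{HS}_{\mathsf{ct}}\not\geq\mathsf{HS}_{\mathsf{lin}}$: there is an $\mathsf{HS}$ formula $\psi$ such that no $\mathsf{HS}$ formula $\psi'$ satisfies $K\models_{\mathsf{st}}\psi'\iff K\models_{\mathsf{lin}}\psi$ for all finite Kripke structures $K$, and no $\mathsf{HS}$ formula $\psi''$ satisfies $K\models_{\mathsf{ct}}\psi''\iff K\models_{\mathsf{lin}}\psi$ for all finite Kripke structures $K$.
   Context: A Kripke structure is $K=(\mathcal{AP},S,\delta,\mu,s_0)$ ($\mathcal{AP}$ finite, left-total $\delta\subseteq S\times S$, $\mu:S\to2^{\mathcal{AP}}$, initial $s_0$); finite if $S$ finite. Infinite paths and traces (non-empty finite paths) follow $\delta$, initial if they start at $s_0$; $\mathrm{lst}(\rho)$ is the last state of a trace. $\mathsf{HS}$: $\psi::=p\mid\neg\psi\mid\psi\wedge\psi\mid\langle B\rangle\psi\mid\langle E\rangle\psi\mid\langle\overline{B}\rangle\psi\mid\langle\overline{E}\rangle\psi$ (other Halpern–Shoham modalities are abbreviations). State-based: on traces, $\rho\models p$ iff $p$ labels every state of $\rho$; $\langle B\rangle$/$\langle E\rangle$: some proper non-empty prefix/suffix satisfies the argument; $\langle\overline{B}\rangle$/$\langle\overline{E}\rangle$: some trace having $\rho$ as proper prefix/suffix satisfies it; $K\models_{\mathsf{st}}\psi$ iff all initial traces satisfy $\psi$. Computation-tree-based: $C(K)$ has states the initial traces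 of $K$, transitions $(\rho,\rho s)$ for $(\mathrm{lst}(\rho),s)\in\delta$, labels $\mu(\mathrm{lst}(\rho))$, initial state $s_0$; $K\models_{\mathsf{ct}}\psi$ iff $C(K)\models_{\mathsf{st}}\psi$. Trace-based: an infinite path $\pi$ induces intervals $[i,j]$ ($i\le j$) labelled $\bigcap_{h=i}^j\mu(\pi(h))$; $\langle B\rangle$: some $[i,j']$, $i\le j'<j$; $\langle E\rangle$: some $[i',j]$, $i<i'\le j$; $\langle\overline{B}\rangle$: some $[i,j']$, $j'>j$; $\langle\overline{E}\rangle$: some $[i',j]$, $i'<i$; $K\models_{\mathsf{lin}}\psi$ iff for every initial infinite path and every $i\ge0$, $[0,i]\models\psi$. -}

module Defs where

open import Data.Nat using (ℕ; zero; suc; _≤_; _<_)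
open import Data.Fin using (Fin)
open import Data.Fin.Subset using (Subset; _∈_)
open import Data.Bool using (Bool; T)
open import Data.List using (List; []; _∷_; _++_; _∷ʳ_)
open import Data.List.NonEmpty using (_∷_) renaming (last to last⁺)
open import Data.List.Relation.Unary.All using (All)
open import Data.List.Relation.Unary.Linked using (Linked)
open import Data.Product using (Σ; ∃; _×_)
open import Relation.Nullary using (¬_)
open import Relation.Binary.PropositionalEquality using (_≡_; _≢_)

data HS (n : ℕ) : Set where
  prop : Fin n → HS n
  neg  : HS n → HS n
  and  : HS n → HS n → HS n
  ⟨B⟩  : HS n → HS n
  ⟨E⟩  : HS n → HS n
  ⟨B̄⟩  : HS n → HS n
  ⟨Ē⟩  : HS n → HS n

-- Left-totality is not needed to define the state-based semantics; it
-- is imposed on the finite structures below (and C(K) is left-total).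
record Kripke (n : ℕ) : Set₁ where
  field
    S  : Set
    δ  : S → S → Set
    μ  : S → Subset n
    s₀ : S

module StSem {n : ℕ} (K : Kripke n) where
  open Kripke K

  -- traces are non-empty lists of states linked by δ
  -- (satisfaction is only ever evaluated on traces)
  sat : List S → HS n → Set
  sat ρ (prop p) = All (λ s → p ∈ μ s) ρ
  sat ρ (neg ψ) = ¬ sat ρ ψ
  sat ρ (and ψ φ) = sat ρ ψ × sat ρ φ
  sat ρ (⟨B⟩ ψ) = Σ (List S) λ ρ' → Σ (List S) λ σ →
    ρ ≡ ρ' ++ σ × ρ' ≢ [] × σ ≢ [] × sat ρ' ψ
  sat ρ (⟨E⟩ ψ) = Σ (List S) λ σ → Σ (List S) λ ρ' →
    ρ ≡ σ ++ ρ' × σ ≢ [] × ρ' ≢ [] × sat ρ' ψ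
  sat ρ (⟨B̄⟩ ψ) = Σ (List S) λ σ →
    σ ≢ [] × Linked δ (ρ ++ σ) × sat (ρ ++ σ) ψ
  sat ρ (⟨Ē⟩ ψ) = Σ (List S) λ σ →
    σ ≢ [] × Linked δ (σ ++ ρ) × sat (σ ++ ρ) ψ

  models : HS n → Set
  models ψ = (xs : List S) → Linked δ (s₀ ∷ xs) → sat (s₀ ∷ xs) ψ

_⊨st_ : {n : ℕ} → Kripke n → HS n → Set
K ⊨st ψ = StSem.models K ψ

record FinKripke (n : ℕ) : Set where
  field
    m     : ℕ
    δ     : Fin m → Fin m → Bool
    total : (s : Fin m) → ∃ λ t → T (δ s t)
    μ     : Fin m → Subset n
    s₀    : Fin m

toKripke : {n : ℕ} → FinKripke n → Kripke n
toKripke K = record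
  { S = Fin m ; δ = λ s t → T (δ s t) ; μ = μ ; s₀ = s₀ }
  where open FinKripke K

module CT {n : ℕ} (K : FinKripke n) where
  open FinKripke K

  Rel : Fin m → Fin m → Set
  Rel s t = T (δ s t)

  CState : Set
  CState = Σ (List (Fin m)) λ xs → Linked Rel (s₀ ∷ xs)

  lst : CState → Fin m
  lst (xs Data.Product., _) = last⁺ (s₀ ∷ xs)

  CTrans : CState → CState → Set
  CTrans (xs Data.Product., _) (ys Data.Product., _) =
    Σ (Fin m) λ s → ys ≡ xs ∷ʳ s × Rel (last⁺ (s₀ ∷ xs)) s

  C : Kripke n
  C = record
    { S = CState
    ; δ = CTrans
    ; μ = λ ρ → μ (lst ρ)
    ; s₀ = [] Data.Product., Linked.[-]
    }
    where import Data.List.Relation.Unary.Linked as Linked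

_⊨ct_ : {n : ℕ} → FinKripke n → HS n → Set
K ⊨ct ψ = CT.C K ⊨st ψ

_⊨stF_ : {n : ℕ} → FinKripke n → HS n → Set
K ⊨stF ψ = toKripke K ⊨st ψ

module LinSem {n : ℕ} (K : FinKripke n) where
  open FinKripke K

  record InfPath : Set where
    field
      π     : ℕ → Fin m
      init  : π 0 ≡ s₀
      steps : (i : ℕ) → T (δ (π i) (π (suc i)))

  -- satisfaction on the interval [i, j] (i ≤ j) of the path π
  sat : (ℕ → Fin m) → ℕ → ℕ → HS n → Set
  sat π i j (prop p) = (h : ℕ) → i ≤ h → h ≤ j → p ∈ μ (π h)
  sat π i j (neg ψ) = ¬ sat π i j ψ
  sat π i j (and ψ φ) = sat π i j ψ × sat π i j φ
  sat π i j (⟨B⟩ ψ) = Σ ℕ λ j' → i ≤ j' × j' < j × sat π i j' ψ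
  sat π i j (⟨E⟩ ψ) = Σ ℕ λ i' → i < i' × i' ≤ j × sat π i' j ψ
  sat π i j (⟨B̄⟩ ψ) = Σ ℕ λ j' → j < j' × sat π i j' ψ
  sat π i j (⟨Ē⟩ ψ) = Σ ℕ λ i' → i' < i × sat π i' j ψ

  models : HS n → Set
  models ψ = (p : InfPath) → (i : ℕ) → sat (InfPath.π p) 0 i ψ

_⊨lin_ : {n : ℕ} → FinKripke n → HS n → Set
K ⊨lin ψ = LinSem.models K ψ

-- Under the trace-based semantics ψ = ⟨B̄⟩⟨E⟩p says that p holds somewhere in the future.
-- It separates two rootings of one finite structure: an unlabelled chain 1 → 2 → ⋯ → cap
-- leading into a p-labelled self-loop, entered either at its first state (every run reaches p)
-- or from an unlabelled self-loop that may be taken forever (some run never does).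
-- Up to the modal depth d of a formula, a trace of this structure is described by its shape
-- (unlabelled states, labelled states, distance of the last unlabelled state from the p-loop),
-- each number known only up to the threshold 2^d. If cap ≥ 2·2^d, shapes that agree up to the
-- threshold can be kept agreeing, up to the halved threshold, through every HS move (an
-- Ehrenfeucht–Fraïssé argument), and every initial trace entering through the loop has an
-- equivalent initial trace of the other rooting. For the computation-tree semantics, traces
-- of C(K) are windows of a history; a bounded morphism sends them to windows of shape
-- histories, on which the same game is played with pairs (shape of the context, shape of the
-- window).
module Submission where

open import Defs
open import Data.Nat
open import Data.Nat.Properties
open import Data.Bool using (Bool; true; T)
open import Data.Fin using (Fin; zero; suc; toℕ; fromℕ<)
open import Data.Fin.Properties using (toℕ-fromℕ<; toℕ-injective; toℕ<n)
open import Data.Fin.Subset using (_∈_)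
open import Data.Vec using ([]; _∷_; here)
open import Data.List using (List; []; _∷_; _++_; _∷ʳ_; length; replicate; map; _∷ʳ′_; initLast)
open import Data.List.Properties
  using (length-++; ++-assoc; ++-identityʳ; ∷-injective; ∷ʳ-injectiveʳ; ++-conicalˡ; ++-conicalʳ; map-++; map-id)
import Data.List.NonEmpty as List⁺
open import Data.List.Relation.Unary.Linked as Linked using (Linked; []; [-]; _∷_)
open import Data.List.Relation.Unary.All as All using (All; []; _∷_)
import Data.List.Relation.Unary.All.Properties as Allₚ
open import Data.Product using (Σ; ∃; _×_; _,_; proj₁; proj₂)
open import Data.Sum using (_⊎_; inj₁; inj₂)
open import Data.Empty using (⊥-elim)
open import Function.Bundles using (_⇔_; Equivalence)
open import Relation.Nullary using (¬_; yes; no)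
open import Level using (0ℓ)
open import Relation.Binary.Core using (Rel)
open import Relation.Binary.PropositionalEquality hiding (J)

depth : ∀ {n} → HS n → ℕ
depth (prop _) = 0
depth (neg φ) = depth φ
depth (and φ ψ) = depth φ ⊔ depth ψ
depth (⟨B⟩ φ) = suc (depth φ)
depth (⟨E⟩ φ) = suc (depth φ)
depth (⟨B̄⟩ φ) = suc (depth φ)
depth (⟨Ē⟩ φ) = suc (depth φ)

-- R d ρ ρ' : the duplicator can survive d more rounds of the HS game from ρ and ρ'.
module Duplicator {n : ℕ} (K : Kripke n) (R : ℕ → List (Kripke.S K) → List (Kripke.S K) → Set) where
  open Kripke K
  open StSem K

  record Split (d : ℕ) (α β ρ' : List S) : Set where
    constructor split
    field
      α' β' : List S
      ρ'≡ : ρ' ≡ α' ++ β'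
      α'≢[] : α' ≢ []
      β'≢[] : β' ≢ []
      related-α : R d α α'
      related-β : R d β β'

  record Strategy : Set where
    field
      symmetric : ∀ {d ρ ρ'} → R d ρ ρ' → R d ρ' ρ
      atoms : ∀ {d ρ ρ'} p → R d ρ ρ' → sat ρ (prop p) → sat ρ' (prop p)
      splits : ∀ {d ρ ρ'} → R (suc d) ρ ρ' → ∀ α β → ρ ≡ α ++ β → α ≢ [] → β ≢ [] → Split d α β ρ'
      extendʳ : ∀ {d ρ ρ'} → R (suc d) ρ ρ' → ∀ σ → σ ≢ [] → Linked δ (ρ ++ σ) →
        Σ (List S) λ σ' → σ' ≢ [] × Linked δ (ρ' ++ σ') × R d (ρ ++ σ) (ρ' ++ σ')
      extendˡ : ∀ {d ρ ρ'} → R (suc d) ρ ρ' → ∀ σ → σ ≢ [] → Linked δ (σ ++ ρ) →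
        Σ (List S) λ σ' → σ' ≢ [] × Linked δ (σ' ++ ρ') × R d (σ ++ ρ) (σ' ++ ρ')

  module _ (strategy : Strategy) where
    open Strategy strategy

    sat-transfer : ∀ φ {d ρ ρ'} → depth φ ≤ d → R d ρ ρ' → sat ρ φ → sat ρ' φ
    sat-transfer (prop p) _ r s = atoms p r s
    sat-transfer (neg φ) le r s s' = s (sat-transfer φ le (symmetric r) s')
    sat-transfer (and φ ψ) le r (s₁ , s₂) =
      sat-transfer φ (m⊔n≤o⇒m≤o (depth φ) (depth ψ) le) r s₁ ,
      sat-transfer ψ (m⊔n≤o⇒n≤o (depth φ) (depth ψ) le) r s₂
    sat-transfer (⟨B⟩ φ) (s≤s le) r (α , β , eq , a , b , s) =
      let open Split (splits r α β eq a b) in α' , β' , ρ'≡ , α'≢[] , β'≢[] , sat-transfer φ le related-α s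
    sat-transfer (⟨E⟩ φ) (s≤s le) r (α , β , eq , a , b , s) =
      let open Split (splits r α β eq a b) in α' , β' , ρ'≡ , α'≢[] , β'≢[] , sat-transfer φ le related-β s
    sat-transfer (⟨B̄⟩ φ) (s≤s le) r (σ , ne , lk , s) with extendʳ r σ ne lk
    ... | σ' , ne' , lk' , r' = σ' , ne' , lk' , sat-transfer φ le r' s
    sat-transfer (⟨Ē⟩ φ) (s≤s le) r (σ , ne , lk , s) with extendˡ r σ ne lk
    ... | σ' , ne' , lk' , r' = σ' , ne' , lk' , sat-transfer φ le r' s

infix 4 _≈[_]_
_≈[_]_ : ℕ → ℕ → ℕ → Set
a ≈[ T ] b = (a ≡ b) ⊎ (T ≤ a × T ≤ b)

≈-refl : ∀ {T a} → a ≈[ T ] a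
≈-refl = inj₁ refl

≈-sym : ∀ {T a b} → a ≈[ T ] b → b ≈[ T ] a
≈-sym (inj₁ e) = inj₁ (sym e)
≈-sym (inj₂ (p , q)) = inj₂ (q , p)

≈-large : ∀ {T a b} → T ≤ a → T ≤ b → a ≈[ T ] b
≈-large p q = inj₂ (p , q)

≈-weaken : ∀ {T T' a b} → T' ≤ T → a ≈[ T ] b → a ≈[ T' ] b
≈-weaken _ (inj₁ e) = inj₁ e
≈-weaken le (inj₂ (p , q)) = inj₂ (≤-trans le p , ≤-trans le q)

≈-+ : ∀ {T a a' b b'} → a ≈[ T ] a' → b ≈[ T ] b' → a + b ≈[ T ] a' + b'
≈-+ (inj₁ refl) (inj₁ refl) = inj₁ refl
≈-+ {a = a} {b = b} {b'} (inj₁ refl) (inj₂ (p , q)) = inj₂ (≤-trans p (m≤n+m b a) , ≤-trans q (m≤n+m b' a))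
≈-+ {a = a} {a'} {b} {b'} (inj₂ (p , q)) _ = inj₂ (≤-trans p (m≤m+n a b) , ≤-trans q (m≤m+n a' b'))

≈-+c : ∀ {T a a'} c → a ≈[ T ] a' → a + c ≈[ T ] a' + c
≈-+c c e = ≈-+ e ≈-refl

≈-c+ : ∀ {T a a'} c → a ≈[ T ] a' → c + a ≈[ T ] c + a'
≈-c+ c e = ≈-+ ≈-refl e

≈-⊓ : ∀ {T a a'} N → T ≤ N → a ≈[ T ] a' → a ⊓ N ≈[ T ] a' ⊓ N
≈-⊓ N le (inj₁ refl) = ≈-refl
≈-⊓ N le (inj₂ (p , q)) = ≈-large (⊓-glb p le) (⊓-glb q le)

≈-⊓-threshold : ∀ a T → a ≈[ T ] a ⊓ T
≈-⊓-threshold a T with ≤-total a T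
... | inj₁ le = inj₁ (sym (m≤n⇒m⊓n≡m le))
... | inj₂ ge = ≈-large ge (≤-reflexive (sym (m≥n⇒m⊓n≡n ge)))

≈-zero : ∀ {T a b} → 1 ≤ T → a ≈[ T ] b → a ≡ 0 → b ≡ 0
≈-zero _ (inj₁ refl) e = e
≈-zero le (inj₂ (p , q)) refl with ≤-trans le p
... | ()

≉-suc-0 : ∀ {T a} → 1 ≤ T → ¬ (suc a ≈[ T ] 0)
≉-suc-0 h e with ≈-zero h (≈-sym e) refl
... | ()

≈-pos : ∀ {T a b} → 1 ≤ T → a ≈[ T ] b → 1 ≤ a → 1 ≤ b
≈-pos {b = zero} le e p with ≈-zero le (≈-sym e) refl
≈-pos {b = zero} le e () | refl
≈-pos {b = suc b} le e p = s≤s z≤n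

-- The duplicator's answer when a is split into i and a ∸ i.
≈-split : ∀ {T T' a a' i} → T' + T' ≤ T → a ≈[ T ] a' → i ≤ a →
  Σ ℕ λ i' → i' ≤ a' × i ≈[ T' ] i' × a ∸ i ≈[ T' ] a' ∸ i'
≈-split {i = i} _ (inj₁ refl) le = i , le , ≈-refl , ≈-refl
≈-split {T} {T'} {a} {a'} {i} h (inj₂ (Ta , Ta')) le with T' ≤? i | T' ≤? (a ∸ i)
... | no i<T' | _ = i , ≤-trans i≤T' (≤-trans (m+n≤o⇒m≤o T' h) Ta') , ≈-refl ,
      ≈-large (rest-large Ta) (rest-large Ta')
  where
    i≤T' : i ≤ T'
    i≤T' = <⇒≤ (≰⇒> i<T')
    rest-large : ∀ {x} → T ≤ x → T' ≤ x ∸ i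
    rest-large Tx = m+n≤o⇒m≤o∸n T' (≤-trans (+-monoʳ-≤ T' i≤T') (≤-trans h Tx))
... | yes T'≤i | no r<T' = a' ∸ (a ∸ i) , m∸n≤m a' (a ∸ i) ,
      ≈-large T'≤i (m+n≤o⇒m≤o∸n T' (≤-trans (+-monoʳ-≤ T' r≤T') (≤-trans h Ta'))) ,
      inj₁ (sym (m∸[m∸n]≡n (≤-trans r≤T' (≤-trans (m+n≤o⇒m≤o T' h) Ta'))))
  where
    r≤T' : a ∸ i ≤ T'
    r≤T' = <⇒≤ (≰⇒> r<T')
... | yes T'≤i | yes T'≤r = T' , ≤-trans (m+n≤o⇒m≤o T' h) Ta' , ≈-large T'≤i ≤-refl ,
      ≈-large T'≤r (m+n≤o⇒m≤o∸n T' (≤-trans h Ta'))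

threshold : ℕ → ℕ
threshold zero = 1
threshold (suc d) = threshold d + threshold d

1≤threshold : ∀ d → 1 ≤ threshold d
1≤threshold zero = s≤s z≤n
1≤threshold (suc d) = ≤-trans (1≤threshold d) (m≤m+n (threshold d) (threshold d))

threshold-mono : ∀ d → threshold d ≤ threshold (suc d)
threshold-mono d = m≤m+n (threshold d) (threshold d)

m+m≤n⇒m≤n : ∀ {m n} → m + m ≤ n → m ≤ n
m+m≤n⇒m≤n {m} = m+n≤o⇒n≤o m

m+m≤n⇒m≤n∸o : ∀ {m n o} → m + m ≤ n → o ≤ m → m ≤ n ∸ o
m+m≤n⇒m≤n∸o {m} h o≤m = m+n≤o⇒m≤o∸n m (≤-trans (+-monoʳ-≤ m o≤m) h)

[o∸n]+[n∸m]≡o∸m : ∀ {m n o} → m ≤ n → n ≤ o → (o ∸ n) + (n ∸ m) ≡ o ∸ m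
[o∸n]+[n∸m]≡o∸m {m} {n} {o} m≤n n≤o = begin
  (o ∸ n) + (n ∸ m) ≡⟨ sym (+-∸-assoc (o ∸ n) m≤n) ⟩
  (o ∸ n + n) ∸ m   ≡⟨ cong (_∸ m) (m∸n+n≡m n≤o) ⟩
  o ∸ m             ∎
  where open ≡-Reasoning

[o∸m]∸[n∸m]≡o∸n : ∀ {m n o} → m ≤ n → n ≤ o → (o ∸ m) ∸ (n ∸ m) ≡ o ∸ n
[o∸m]∸[n∸m]≡o∸n {m} {n} {o} m≤n n≤o = begin
  (o ∸ m) ∸ (n ∸ m)             ≡⟨ cong (_∸ (n ∸ m)) (sym ([o∸n]+[n∸m]≡o∸m m≤n n≤o)) ⟩
  ((o ∸ n) + (n ∸ m)) ∸ (n ∸ m) ≡⟨ m+n∸n≡m (o ∸ n) (n ∸ m) ⟩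
  o ∸ n                         ∎
  where open ≡-Reasoning

[k+m]∸j≡m∸[j∸k] : ∀ {k j} m → k ≤ j → (k + m) ∸ j ≡ m ∸ (j ∸ k)
[k+m]∸j≡m∸[j∸k] {k} {j} m k≤j = begin
  (k + m) ∸ j             ≡⟨ cong ((k + m) ∸_) (sym (m+[n∸m]≡n k≤j)) ⟩
  (k + m) ∸ (k + (j ∸ k)) ≡⟨ [m+n]∸[m+o]≡n∸o k m (j ∸ k) ⟩
  m ∸ (j ∸ k)             ∎
  where open ≡-Reasoning

m≡[j∸k]+[k+m∸j] : ∀ {k j m} → k ≤ j → j ≤ k + m → m ≡ (j ∸ k) + ((k + m) ∸ j)
m≡[j∸k]+[k+m∸j] {k} {j} {m} k≤j j≤k+m = begin
  m                       ≡⟨ sym (m+n∸m≡n k m) ⟩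
  (k + m) ∸ k             ≡⟨ sym ([o∸n]+[n∸m]≡o∸m k≤j j≤k+m) ⟩
  ((k + m) ∸ j) + (j ∸ k) ≡⟨ +-comm ((k + m) ∸ j) (j ∸ k) ⟩
  (j ∸ k) + ((k + m) ∸ j) ∎
  where open ≡-Reasoning

k<j≤k+m⇒1≤m : ∀ {k j m} → k < j → j ≤ k + m → 1 ≤ m
k<j≤k+m⇒1≤m {k} {j} {m} lt le = +-cancelˡ-≤ k 1 m (subst (_≤ k + m) (+-comm 1 k) (≤-trans lt le))

k<j+i⇒k∸j<i : ∀ {j k i} → j ≤ k → k < j + i → k ∸ j < i
k<j+i⇒k∸j<i {j} {k} {i} jk jik = +-cancelˡ-< j (k ∸ j) i (subst (_< j + i) (sym (m+[n∸m]≡n jk)) jik)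

1≤m∸n⇒n<m : ∀ {m n} → 1 ≤ m ∸ n → n < m
1≤m∸n⇒n<m p = m∸n≢0⇒n<m (λ e → <⇒≱ p (≤-reflexive e))

[m+o]∸[n+o]≡m∸n : ∀ m n o → (m + o) ∸ (n + o) ≡ m ∸ n
[m+o]∸[n+o]≡m∸n m n o rewrite +-comm m o | +-comm n o = [m+n]∸[m+o]≡n∸o o m n

[n∸b]∸a≡n∸[a+b] : ∀ n a b → (n ∸ b) ∸ a ≡ n ∸ (a + b)
[n∸b]∸a≡n∸[a+b] n a b = trans (∸-+-assoc n b a) (cong (n ∸_) (+-comm b a))

suc[n∸suc-L]≡n∸L : ∀ n L → suc L ≤ n → suc (n ∸ suc L) ≡ n ∸ L
suc[n∸suc-L]≡n∸L n L le = sym (+-∸-assoc 1 le)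

[n∸[a+b]]+a≡n∸b : ∀ n a b → a + b ≤ n → (n ∸ (a + b)) + a ≡ n ∸ b
[n∸[a+b]]+a≡n∸b n a b le = begin
  (n ∸ (a + b)) + a             ≡⟨ sym (m+n∸n≡m (n ∸ (a + b) + a) b) ⟩
  ((n ∸ (a + b)) + a) + b ∸ b   ≡⟨ cong (_∸ b) (+-assoc (n ∸ (a + b)) a b) ⟩
  (n ∸ (a + b)) + (a + b) ∸ b   ≡⟨ cong (_∸ b) (m∸n+n≡m le) ⟩
  n ∸ b                         ∎
  where open ≡-Reasoning

∈-singleton⇒T : ∀ {b} → zero ∈ (b ∷ []) → T b
∈-singleton⇒T here = _

T⇒∈-singleton : ∀ {b} → T b → zero ∈ (b ∷ [])
T⇒∈-singleton {true} _ = here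

≢[]⇒1≤length : ∀ {A : Set} (xs : List A) → xs ≢ [] → 1 ≤ length xs
≢[]⇒1≤length [] ne = ⊥-elim (ne refl)
≢[]⇒1≤length (x ∷ xs) _ = s≤s z≤n

1≤length⇒≢[] : ∀ {A : Set} (xs : List A) → 1 ≤ length xs → xs ≢ []
1≤length⇒≢[] [] () _
1≤length⇒≢[] (x ∷ xs) _ ()

++-≢[]ˡ : ∀ {A : Set} (xs ys : List A) → xs ≢ [] → xs ++ ys ≢ []
++-≢[]ˡ xs ys ne e = ne (++-conicalˡ xs ys e)

++-≢[]ʳ : ∀ {A : Set} (xs ys : List A) → ys ≢ [] → xs ++ ys ≢ []
++-≢[]ʳ xs ys ne e = ne (++-conicalʳ xs ys e)

++-injective-length : ∀ {A : Set} (xs ys xs' ys' : List A) → xs ++ ys ≡ xs' ++ ys' →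
  length xs ≡ length xs' → xs ≡ xs' × ys ≡ ys'
++-injective-length [] ys [] ys' e _ = refl , e
++-injective-length (x ∷ xs) ys (x' ∷ xs') ys' e l with ∷-injective e
... | refl , e' with ++-injective-length xs ys xs' ys' e' (suc-injective l)
... | refl , e'' = refl , e''

module _ {A : Set} {R : Rel A 0ℓ} where

  Linked-++⁻ˡ : ∀ (xs ys : List A) → Linked R (xs ++ ys) → Linked R xs
  Linked-++⁻ˡ [] ys _ = []
  Linked-++⁻ˡ (x ∷ []) ys _ = [-]
  Linked-++⁻ˡ (x ∷ y ∷ xs) ys (r ∷ l) = r ∷ Linked-++⁻ˡ (y ∷ xs) ys l

  Linked-++⁻ʳ : ∀ (xs ys : List A) → Linked R (xs ++ ys) → Linked R ys
  Linked-++⁻ʳ [] ys l = l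
  Linked-++⁻ʳ (x ∷ xs) ys l = Linked-++⁻ʳ xs ys (Linked.tail l)

  Linked-∷ʳ∷ʳ⁻ : ∀ xs {z y} → Linked R (xs ∷ʳ z ∷ʳ y) → R z y
  Linked-∷ʳ∷ʳ⁻ [] (r ∷ _) = r
  Linked-∷ʳ∷ʳ⁻ (x ∷ xs) l = Linked-∷ʳ∷ʳ⁻ xs (Linked.tail l)

  Linked-∷ʳ⁻ : ∀ x xs y → Linked R ((x ∷ xs) ∷ʳ y) → R (List⁺.last (x List⁺.∷ xs)) y
  Linked-∷ʳ⁻ x xs y l with initLast xs
  Linked-∷ʳ⁻ x .[] y (r ∷ _) | [] = r
  Linked-∷ʳ⁻ x .(ys ∷ʳ z) y l | ys ∷ʳ′ z = Linked-∷ʳ∷ʳ⁻ (x ∷ ys) l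

length≡1⇒singleton : ∀ {A : Set} (xs : List A) → length xs ≡ 1 → Σ A λ x → xs ≡ x ∷ []
length≡1⇒singleton (x ∷ []) _ = x , refl

∷≡∷ʳ⁻ : ∀ {A : Set} {x : A} {xs zs s} → x ∷ xs ≡ zs ∷ʳ s → zs ≢ [] → Σ (List A) λ ys → zs ≡ x ∷ ys × xs ≡ ys ∷ʳ s
∷≡∷ʳ⁻ {zs = []} _ ne = ⊥-elim (ne refl)
∷≡∷ʳ⁻ {zs = z ∷ ys} e _ with ∷-injective e
... | refl , xs≡ = ys , refl , xs≡

map-++⁻ : ∀ {A B : Set} (F : A → B) (ρ : List A) (α' β' : List B) → map F ρ ≡ α' ++ β' →
  Σ (List A) λ α → Σ (List A) λ β → ρ ≡ α ++ β × map F α ≡ α' × map F β ≡ β'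
map-++⁻ F ρ [] β' e = [] , ρ , refl , refl , e
map-++⁻ F (x ∷ ρ) (a ∷ α') β' e with ∷-injective e
... | refl , e' with map-++⁻ F ρ α' β' e'
... | α , β , refl , refl , refl = x ∷ α , β , refl , refl , refl

map-≢[] : ∀ {A B : Set} (F : A → B) (xs : List A) → xs ≢ [] → map F xs ≢ []
map-≢[] F [] ne = ⊥-elim (ne refl)
map-≢[] F (x ∷ xs) ne ()

map-≢[]⁻ : ∀ {A B : Set} (F : A → B) (xs : List A) → map F xs ≢ [] → xs ≢ []
map-≢[]⁻ F [] ne _ = ne refl
map-≢[]⁻ F (x ∷ xs) ne ()

-- Shapes of traces of the chain structure below, cap being the length of its unlabelled chain:
-- k unlabelled states followed by m labelled ones, the last unlabelled state lying f steps
-- (at most cap) before the end of the chain; f is meaningless, and kept 0, when m > 0.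
module Shapes (cap : ℕ) where

  record Shape : Set where
    constructor shape
    field
      k f m : ℕ
  open Shape public

  shape-cong : ∀ {k k' f f' m m'} → k ≡ k' → f ≡ f' → m ≡ m' → shape k f m ≡ shape k' f' m'
  shape-cong refl refl refl = refl

  size : Shape → ℕ
  size τ = k τ + m τ

  GapVanishes : Shape → Set
  GapVanishes τ = 1 ≤ m τ → f τ ≡ 0

  Valid : Shape → Set
  Valid τ = (1 ≤ size τ) × (f τ ≤ cap) × GapVanishes τ

  Similar : ℕ → Shape → Shape → Set
  Similar T τ τ' = (k τ ≈[ T ] k τ') × (m τ ≈[ T ] m τ') × (1 ≤ k τ → f τ ≈[ T ] f τ')

  -- Going back along the chain from the last unlabelled state increases f, up to cap
  -- (before the chain there is only the unlabelled loop).
  takeˢ : Shape → ℕ → Shape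
  takeˢ (shape k f m) j with j ≤? k
  ... | yes _ = shape j ((f + (k ∸ j)) ⊓ cap) 0
  ... | no _ = shape k f (j ∸ k)

  dropˢ : Shape → ℕ → Shape
  dropˢ (shape k f m) j with j ≤? k
  ... | yes _ = shape (k ∸ j) f m
  ... | no _ = shape 0 0 ((k + m) ∸ j)

  gap-++ : ℕ → ℕ → ℕ → ℕ
  gap-++ f₁ zero f₂ = f₁
  gap-++ f₁ (suc _) f₂ = f₂

  infixr 5 _++ˢ_
  _++ˢ_ : Shape → Shape → Shape
  shape k₁ f₁ m₁ ++ˢ shape k₂ f₂ m₂ = shape (k₁ + k₂) (gap-++ f₁ (k₂ + m₂) f₂) (m₁ + m₂)

  takeˢ-≤ : ∀ k f m j → j ≤ k → takeˢ (shape k f m) j ≡ shape j ((f + (k ∸ j)) ⊓ cap) 0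
  takeˢ-≤ k f m j le with j ≤? k
  ... | yes _ = refl
  ... | no j≰k = ⊥-elim (j≰k le)

  takeˢ-> : ∀ k f m j → k < j → takeˢ (shape k f m) j ≡ shape k f (j ∸ k)
  takeˢ-> k f m j lt with j ≤? k
  ... | yes le = ⊥-elim (<⇒≱ lt le)
  ... | no _ = refl

  dropˢ-≤ : ∀ k f m j → j ≤ k → dropˢ (shape k f m) j ≡ shape (k ∸ j) f m
  dropˢ-≤ k f m j le with j ≤? k
  ... | yes _ = refl
  ... | no j≰k = ⊥-elim (j≰k le)

  dropˢ-> : ∀ k f m j → k < j → dropˢ (shape k f m) j ≡ shape 0 0 ((k + m) ∸ j)
  dropˢ-> k f m j lt with j ≤? k
  ... | yes le = ⊥-elim (<⇒≱ lt le)
  ... | no _ = refl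

  [a⊓cap+b]⊓cap≡[a+b]⊓cap : ∀ a b → (a ⊓ cap + b) ⊓ cap ≡ (a + b) ⊓ cap
  [a⊓cap+b]⊓cap≡[a+b]⊓cap a b with ≤-total a cap
  ... | inj₁ le rewrite m≤n⇒m⊓n≡m le = refl
  ... | inj₂ ge rewrite m≥n⇒m⊓n≡n ge | m≥n⇒m⊓n≡n (m≤m+n cap b) | m≥n⇒m⊓n≡n (≤-trans ge (m≤m+n a b)) = refl

  [f+0]⊓cap≡f : ∀ {f} → f ≤ cap → (f + 0) ⊓ cap ≡ f
  [f+0]⊓cap≡f {f} le rewrite +-identityʳ f = m≤n⇒m⊓n≡m le

  gap-++-0 : ∀ x → gap-++ 0 x 0 ≡ 0
  gap-++-0 zero = refl
  gap-++-0 (suc x) = refl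

  gap-++-0ʳ : ∀ {f} x → f ≡ 0 → f ≡ gap-++ f x 0
  gap-++-0ʳ x refl = sym (gap-++-0 x)

  gap-++-takeˢ : ∀ {f} → f ≤ cap → ∀ a b → f ≡ gap-++ ((f + a) ⊓ cap) (a + b) f
  gap-++-takeˢ f≤cap zero zero = sym ([f+0]⊓cap≡f f≤cap)
  gap-++-takeˢ f≤cap zero (suc b) = refl
  gap-++-takeˢ f≤cap (suc a) b = refl

  labelled-takeˢ : ∀ m x → takeˢ (shape 0 0 m) x ≡ shape 0 0 x
  labelled-takeˢ m zero = refl
  labelled-takeˢ m (suc x) = takeˢ-> 0 0 m (suc x) (s≤s z≤n)

  labelled-dropˢ : ∀ m x → dropˢ (shape 0 0 m) x ≡ shape 0 0 (m ∸ x)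
  labelled-dropˢ m zero = refl
  labelled-dropˢ m (suc x) = dropˢ-> 0 0 m (suc x) (s≤s z≤n)

  takeˢ-takeˢ : ∀ τ {j J} → j ≤ J → takeˢ (takeˢ τ J) j ≡ takeˢ τ j
  takeˢ-takeˢ (shape k f m) {j} {J} jJ with ≤-<-connex J k
  ... | inj₁ Jk rewrite takeˢ-≤ k f m J Jk
                     | takeˢ-≤ J ((f + (k ∸ J)) ⊓ cap) 0 j jJ
                     | takeˢ-≤ k f m j (≤-trans jJ Jk)
                     | [a⊓cap+b]⊓cap≡[a+b]⊓cap (f + (k ∸ J)) (J ∸ j)
                     | +-assoc f (k ∸ J) (J ∸ j)
                     | [o∸n]+[n∸m]≡o∸m jJ Jk = refl
  ... | inj₂ Jk rewrite takeˢ-> k f m J Jk with ≤-<-connex j k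
  ...   | inj₁ jk rewrite takeˢ-≤ k f (J ∸ k) j jk | takeˢ-≤ k f m j jk = refl
  ...   | inj₂ jk rewrite takeˢ-> k f (J ∸ k) j jk | takeˢ-> k f m j jk = refl

  dropˢ-takeˢ : ∀ τ {j J} → j ≤ J → dropˢ (takeˢ τ J) j ≡ takeˢ (dropˢ τ j) (J ∸ j)
  dropˢ-takeˢ (shape k f m) {j} {J} jJ with ≤-<-connex J k
  ... | inj₁ Jk rewrite takeˢ-≤ k f m J Jk
                     | dropˢ-≤ J ((f + (k ∸ J)) ⊓ cap) 0 j jJ
                     | dropˢ-≤ k f m j (≤-trans jJ Jk)
                     | takeˢ-≤ (k ∸ j) f m (J ∸ j) (∸-monoˡ-≤ j Jk)
                     | [o∸m]∸[n∸m]≡o∸n jJ Jk = refl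
  ... | inj₂ Jk rewrite takeˢ-> k f m J Jk with ≤-<-connex j k
  ...   | inj₁ jk rewrite dropˢ-≤ k f (J ∸ k) j jk
                       | dropˢ-≤ k f m j jk
                       | takeˢ-> (k ∸ j) f m (J ∸ j) (∸-monoˡ-< Jk jk)
                       | [o∸m]∸[n∸m]≡o∸n jk (<⇒≤ Jk) = refl
  ...   | inj₂ jk rewrite dropˢ-> k f (J ∸ k) j jk
                       | dropˢ-> k f m j jk
                       | m+[n∸m]≡n (<⇒≤ Jk) = sym (labelled-takeˢ ((k + m) ∸ j) (J ∸ j))

  dropˢ-via-takeˢ : ∀ τ {j J} → Valid τ → j ≤ J → J ≤ size τ → dropˢ τ j ≡ dropˢ (takeˢ τ J) j ++ˢ dropˢ τ J
  dropˢ-via-takeˢ (shape k f m) {j} {J} (_ , f≤cap , vm) jJ Jl with ≤-<-connex J k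
  ... | inj₁ Jk rewrite takeˢ-≤ k f m J Jk
                     | dropˢ-≤ J ((f + (k ∸ J)) ⊓ cap) 0 j jJ
                     | dropˢ-≤ k f m j (≤-trans jJ Jk)
                     | dropˢ-≤ k f m J Jk
                     | +-comm (J ∸ j) (k ∸ J)
                     | [o∸n]+[n∸m]≡o∸m jJ Jk = cong (λ g → shape (k ∸ j) g m) (gap-++-takeˢ f≤cap (k ∸ J) m)
  ... | inj₂ Jk rewrite takeˢ-> k f m J Jk with ≤-<-connex j k
  ...   | inj₁ jk rewrite dropˢ-≤ k f (J ∸ k) j jk
                       | dropˢ-≤ k f m j jk
                       | dropˢ-> k f m J Jk
                       | +-identityʳ (k ∸ j) =
    cong₂ (shape (k ∸ j)) (gap-++-0ʳ ((k + m) ∸ J) (vm (k<j≤k+m⇒1≤m Jk Jl))) (m≡[j∸k]+[k+m∸j] (<⇒≤ Jk) Jl)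
  ...   | inj₂ jk rewrite dropˢ-> k f (J ∸ k) j jk
                      | dropˢ-> k f m j jk
                      | dropˢ-> k f m J Jk
                      | m+[n∸m]≡n (<⇒≤ Jk)
                      | gap-++-0 ((k + m) ∸ J)
                      | +-comm (J ∸ j) ((k + m) ∸ J)
                      | [o∸n]+[n∸m]≡o∸m jJ Jl = refl

  takeˢ-+ : ∀ τ {j i} → Valid τ → j + i ≤ size τ → takeˢ τ (j + i) ≡ takeˢ τ j ++ˢ takeˢ (dropˢ τ j) i
  takeˢ-+ (shape k f m) {j} {i} (_ , f≤cap , vm) le with ≤-<-connex (j + i) k
  ... | inj₁ jik rewrite takeˢ-≤ k f m (j + i) jik
                      | takeˢ-≤ k f m j (m+n≤o⇒m≤o j jik)
                      | dropˢ-≤ k f m j (m+n≤o⇒m≤o j jik)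
                      | takeˢ-≤ (k ∸ j) f m i (m+n≤o⇒m≤o∸n i (subst (_≤ k) (+-comm j i) jik)) = unlabelled i
    where
      unlabelled : ∀ x → shape (j + x) ((f + (k ∸ (j + x))) ⊓ cap) 0 ≡
                         shape j ((f + (k ∸ j)) ⊓ cap) 0 ++ˢ shape x ((f + ((k ∸ j) ∸ x)) ⊓ cap) 0
      unlabelled zero rewrite +-identityʳ j = refl
      unlabelled (suc x) rewrite ∸-+-assoc k j (suc x) = refl
  ... | inj₂ jik with ≤-<-connex j k
  ...   | inj₁ jk rewrite takeˢ-> k f m (j + i) jik
                       | takeˢ-≤ k f m j jk
                       | dropˢ-≤ k f m j jk
                       | takeˢ-> (k ∸ j) f m i (k<j+i⇒k∸j<i jk jik)
                       | m+[n∸m]≡n jk =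
    cong₂ (shape k) (crossing (k ∸ j) (i ∸ (k ∸ j)) (m+[n∸m]≡n (<⇒≤ (k<j+i⇒k∸j<i jk jik)))) (sym labelled)
    where
      crossing : ∀ a b → a + b ≡ i → f ≡ gap-++ ((f + (k ∸ j)) ⊓ cap) (a + b) f
      crossing zero zero e = ⊥-elim (<⇒≱ (k<j+i⇒k∸j<i jk jik) (subst (_≤ k ∸ j) e z≤n))
      crossing zero (suc b) e = refl
      crossing (suc a) b e = refl
      labelled : i ∸ (k ∸ j) ≡ (j + i) ∸ k
      labelled = begin
        i ∸ (k ∸ j)             ≡⟨ sym ([m+n]∸[m+o]≡n∸o j i (k ∸ j)) ⟩
        (j + i) ∸ (j + (k ∸ j)) ≡⟨ cong ((j + i) ∸_) (m+[n∸m]≡n jk) ⟩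
        (j + i) ∸ k             ∎
        where open ≡-Reasoning
  ...   | inj₂ jk rewrite takeˢ-> k f m (j + i) jik
                       | takeˢ-> k f m j jk
                       | dropˢ-> k f m j jk
                       | labelled-takeˢ ((k + m) ∸ j) i
                       | +-identityʳ k
                       | +-∸-comm i (<⇒≤ jk) = cong (λ g → shape k g ((j ∸ k) + i)) (gap-++-0ʳ i F≡0)
    where
      F≡0 : f ≡ 0
      F≡0 = vm (k<j≤k+m⇒1≤m jk (≤-trans (m≤m+n j i) le))

  dropˢ-dropˢ : ∀ τ {j i} → dropˢ (dropˢ τ j) i ≡ dropˢ τ (j + i)
  dropˢ-dropˢ (shape k f m) {j} {i} with ≤-<-connex (j + i) k
  ... | inj₁ jik rewrite dropˢ-≤ k f m j (m+n≤o⇒m≤o j jik)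
                      | dropˢ-≤ (k ∸ j) f m i (m+n≤o⇒m≤o∸n i (subst (_≤ k) (+-comm j i) jik))
                      | dropˢ-≤ k f m (j + i) jik
                      | ∸-+-assoc k j i = refl
  ... | inj₂ jik with ≤-<-connex j k
  ...   | inj₁ jk rewrite dropˢ-≤ k f m j jk
                       | dropˢ-> (k ∸ j) f m i (k<j+i⇒k∸j<i jk jik)
                       | dropˢ-> k f m (j + i) jik
                       | sym (+-∸-comm m jk)
                       | ∸-+-assoc (k + m) j i = refl
  ...   | inj₂ jk rewrite dropˢ-> k f m j jk
                       | dropˢ-> k f m (j + i) jik
                       | labelled-dropˢ ((k + m) ∸ j) i
                       | ∸-+-assoc (k + m) j i = refl

  takeˢ++dropˢ : ∀ τ {j} → Valid τ → j ≤ size τ → τ ≡ takeˢ τ j ++ˢ dropˢ τ j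
  takeˢ++dropˢ (shape k f m) {j} (_ , f≤cap , vm) le with ≤-<-connex j k
  ... | inj₁ jk rewrite takeˢ-≤ k f m j jk
                     | dropˢ-≤ k f m j jk
                     | m+[n∸m]≡n jk = cong (λ g → shape k g m) (gap-++-takeˢ f≤cap (k ∸ j) m)
  ... | inj₂ jk rewrite takeˢ-> k f m j jk
                     | dropˢ-> k f m j jk
                     | +-identityʳ k =
    cong₂ (shape k) (gap-++-0ʳ ((k + m) ∸ j) (vm (k<j≤k+m⇒1≤m jk le))) (m≡[j∸k]+[k+m∸j] (<⇒≤ jk) le)

  takeˢ-size : ∀ τ → Valid τ → takeˢ τ (size τ) ≡ τ
  takeˢ-size (shape k f zero) (_ , f≤cap , _)
    rewrite +-identityʳ k | takeˢ-≤ k f 0 k ≤-refl | n∸n≡0 k | [f+0]⊓cap≡f f≤cap = refl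
  takeˢ-size (shape k f (suc m)) _
    rewrite takeˢ-> k f (suc m) (k + suc m) (subst (k <_) (sym (+-suc k m)) (s≤s (m≤m+n k m)))
          | m+n∸m≡n k (suc m) = refl

  size-takeˢ : ∀ τ {j} → j ≤ size τ → size (takeˢ τ j) ≡ j
  size-takeˢ (shape k f m) {j} le with ≤-<-connex j k
  ... | inj₁ jk rewrite takeˢ-≤ k f m j jk = +-identityʳ j
  ... | inj₂ jk rewrite takeˢ-> k f m j jk = m+[n∸m]≡n (<⇒≤ jk)

  size-dropˢ : ∀ τ j → size (dropˢ τ j) ≡ size τ ∸ j
  size-dropˢ (shape k f m) j with ≤-<-connex j k
  ... | inj₁ jk rewrite dropˢ-≤ k f m j jk = sym (+-∸-comm m jk)
  ... | inj₂ jk rewrite dropˢ-> k f m j jk = refl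

  GapVanishes-takeˢ : ∀ τ {j} → GapVanishes τ → j ≤ size τ → GapVanishes (takeˢ τ j)
  GapVanishes-takeˢ (shape k f m) {j} vm le with ≤-<-connex j k
  ... | inj₁ jk rewrite takeˢ-≤ k f m j jk = λ ()
  ... | inj₂ jk rewrite takeˢ-> k f m j jk = λ _ → vm (k<j≤k+m⇒1≤m jk le)

  GapVanishes-dropˢ : ∀ τ j → GapVanishes τ → GapVanishes (dropˢ τ j)
  GapVanishes-dropˢ (shape k f m) j vm with ≤-<-connex j k
  ... | inj₁ jk rewrite dropˢ-≤ k f m j jk = vm
  ... | inj₂ jk rewrite dropˢ-> k f m j jk = λ _ → refl

  f-takeˢ≤cap : ∀ τ j → f τ ≤ cap → f (takeˢ τ j) ≤ cap
  f-takeˢ≤cap (shape k f m) j f≤cap with ≤-<-connex j k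
  ... | inj₁ jk rewrite takeˢ-≤ k f m j jk = m⊓n≤n _ cap
  ... | inj₂ jk rewrite takeˢ-> k f m j jk = f≤cap

  f-dropˢ≤cap : ∀ τ j → f τ ≤ cap → f (dropˢ τ j) ≤ cap
  f-dropˢ≤cap (shape k f m) j f≤cap with ≤-<-connex j k
  ... | inj₁ jk rewrite dropˢ-≤ k f m j jk = f≤cap
  ... | inj₂ jk rewrite dropˢ-> k f m j jk = z≤n

  Valid-takeˢ : ∀ τ {j} → Valid τ → 1 ≤ j → j ≤ size τ → Valid (takeˢ τ j)
  Valid-takeˢ τ {j} (_ , f≤cap , vm) 1≤j le =
    subst (1 ≤_) (sym (size-takeˢ τ le)) 1≤j , f-takeˢ≤cap τ j f≤cap , GapVanishes-takeˢ τ vm le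

  Valid-dropˢ : ∀ τ {j} → Valid τ → j < size τ → Valid (dropˢ τ j)
  Valid-dropˢ τ {j} (_ , f≤cap , vm) lt =
    subst (1 ≤_) (sym (size-dropˢ τ j)) (m<n⇒0<n∸m lt) , f-dropˢ≤cap τ j f≤cap , GapVanishes-dropˢ τ j vm

  1≤m-takeˢ⇒k< : ∀ τ i → 1 ≤ m (takeˢ τ i) → k τ < i
  1≤m-takeˢ⇒k< (shape k f m) i p with ≤-<-connex i k
  ... | inj₁ i≤k rewrite takeˢ-≤ k f m i i≤k = ⊥-elim (<⇒≱ p z≤n)
  ... | inj₂ k<i = k<i

  k<⇒1≤m-takeˢ : ∀ τ i → k τ < i → 1 ≤ m (takeˢ τ i)
  k<⇒1≤m-takeˢ (shape k f m) i k<i rewrite takeˢ-> k f m i k<i = m<n⇒0<n∸m k<i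

  k≤⇒k-dropˢ≡0 : ∀ τ j → k τ ≤ j → k (dropˢ τ j) ≡ 0
  k≤⇒k-dropˢ≡0 (shape k f m) j k≤j with ≤-<-connex j k
  ... | inj₁ j≤k rewrite dropˢ-≤ k f m j j≤k = m≤n⇒m∸n≡0 k≤j
  ... | inj₂ k<j rewrite dropˢ-> k f m j k<j = refl

  k-dropˢ≡0⇒k≤ : ∀ τ j → k (dropˢ τ j) ≡ 0 → k τ ≤ j
  k-dropˢ≡0⇒k≤ (shape k f m) j e with ≤-<-connex j k
  ... | inj₁ j≤k rewrite dropˢ-≤ k f m j j≤k = m∸n≡0⇒m≤n e
  ... | inj₂ k<j = <⇒≤ k<j

  dropˢ-0 : ∀ τ → dropˢ τ 0 ≡ τ
  dropˢ-0 (shape k f m) = dropˢ-≤ k f m 0 z≤n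

  similar-refl : ∀ {T τ} → Similar T τ τ
  similar-refl = ≈-refl , ≈-refl , λ _ → ≈-refl

  similar-sym : ∀ {T τ τ'} → 1 ≤ T → Similar T τ τ' → Similar T τ' τ
  similar-sym h (ek , em , ef) = ≈-sym ek , ≈-sym em , λ p → ≈-sym (ef (≈-pos h (≈-sym ek) p))

  similar-weaken : ∀ {T T' τ τ'} → T' ≤ T → Similar T τ τ' → Similar T' τ τ'
  similar-weaken le (ek , em , ef) = ≈-weaken le ek , ≈-weaken le em , λ p → ≈-weaken le (ef p)

  similar-resp : ∀ {T τ₁ τ₂ σ₁ σ₂} → τ₁ ≡ σ₁ → τ₂ ≡ σ₂ → Similar T σ₁ σ₂ → Similar T τ₁ τ₂
  similar-resp refl refl s = s

  1≤size-similar : ∀ {T τ τ'} → 1 ≤ T → Similar T τ τ' → 1 ≤ size τ → 1 ≤ size τ'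
  1≤size-similar {τ = shape (suc _) _ _} {shape k' _ m'} h (ek , _ , _) _
      = ≤-trans (≈-pos h ek (s≤s z≤n)) (m≤m+n k' m')
  1≤size-similar {τ = shape zero _ _} {shape k' _ m'} h (_ , em , _) p = ≤-trans (≈-pos h em p) (m≤n+m m' k')

  similar-++ˢ : ∀ {T a a' b b'} → 1 ≤ T → Similar T a a' → Similar T b b' → GapVanishes b → GapVanishes b' →
    Similar T (a ++ˢ b) (a' ++ˢ b')
  similar-++ˢ {T} {shape ka fa ma} {shape ka' fa' ma'} {shape kb fb mb} {shape kb' fb' mb'}
    h (ek₁ , em₁ , ef₁) (ek₂ , em₂ , ef₂) vb vb' = ≈-+ ek₁ ek₂ , ≈-+ em₁ em₂ , gap kb mb kb' mb' ek₂ em₂ vb vb' ef₂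
    where
      gap : ∀ kb mb kb' mb' → kb ≈[ T ] kb' → mb ≈[ T ] mb' → (1 ≤ mb → fb ≡ 0) → (1 ≤ mb' → fb' ≡ 0) →
        (1 ≤ kb → fb ≈[ T ] fb') → 1 ≤ ka + kb → gap-++ fa (kb + mb) fb ≈[ T ] gap-++ fa' (kb' + mb') fb'
      gap (suc _) _ (suc _) _ _ _ _ _ ef _ = ef (s≤s z≤n)
      gap (suc _) _ zero _ ek _ _ _ _ _ = ⊥-elim (≉-suc-0 h ek)
      gap zero _ (suc _) _ ek _ _ _ _ _ = ⊥-elim (≉-suc-0 h (≈-sym ek))
      gap zero zero zero zero _ _ _ _ _ p = ef₁ (subst (1 ≤_) (+-identityʳ ka) p)
      gap zero zero zero (suc _) _ em _ _ _ _ = ⊥-elim (≉-suc-0 h (≈-sym em))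
      gap zero (suc _) zero zero _ em _ _ _ _ = ⊥-elim (≉-suc-0 h em)
      gap zero (suc _) zero (suc _) _ _ v v' _ _ rewrite v (s≤s z≤n) | v' (s≤s z≤n) = ≈-refl

  similar-takeˢ-0 : ∀ {T} τ τ' → Similar T (takeˢ τ 0) (takeˢ τ' 0)
  similar-takeˢ-0 (shape k f m) (shape k' f' m') rewrite takeˢ-≤ k f m 0 z≤n | takeˢ-≤ k' f' m' 0 z≤n
      = ≈-refl , ≈-refl , λ ()

  record SplitAnswer (T : ℕ) (τ τ' : Shape) (j : ℕ) : Set where
    constructor splitAnswer
    field
      j' : ℕ
      j'≤size : j' ≤ size τ'
      similar-takeˢ : Similar T (takeˢ τ j) (takeˢ τ' j')
      similar-dropˢ : Similar T (dropˢ τ j) (dropˢ τ' j')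

  similar-split : ∀ {T T'} τ τ' → 1 ≤ T' → T' + T' ≤ T → T' ≤ cap → Similar T τ τ' → ∀ {j} → j ≤ size τ →
    SplitAnswer T' τ τ' j
  similar-split {T} {T'} (shape k f m) (shape k' f' m') 1≤T' h T'≤cap (ek , em , ef) {j} j≤size with ≤-<-connex j k
  ... | inj₁ j≤k with ≈-split h ek j≤k
  ...   | j' , j'≤k' , ej , ekj = splitAnswer j' (≤-trans j'≤k' (m≤m+n k' m'))
    (similar-resp (takeˢ-≤ k f m j j≤k) (takeˢ-≤ k' f' m' j' j'≤k')
      (ej , ≈-refl , λ p → ≈-⊓ cap T'≤cap (≈-+ (≈-weaken (m+m≤n⇒m≤n h) (ef (≤-trans p j≤k))) ekj)))
    (similar-resp (dropˢ-≤ k f m j j≤k) (dropˢ-≤ k' f' m' j' j'≤k')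
      (ekj , ≈-weaken (m+m≤n⇒m≤n h) em , λ p → ≈-weaken (m+m≤n⇒m≤n h) (ef (≤-trans p (m∸n≤m k j)))))
  similar-split {T} {T'} (shape k f m) (shape k' f' m') 1≤T' h T'≤cap (ek , em , ef) {j} j≤size
    | inj₂ k<j with ≈-split {i = j ∸ k} h em (subst (j ∸ k ≤_) (m+n∸m≡n k m) (∸-monoˡ-≤ k j≤size))
  ...   | i' , i'≤m' , ei , emi = splitAnswer (k' + i') (+-monoʳ-≤ k' i'≤m')
    (similar-resp (takeˢ-> k f m j k<j) (takeˢ-> k' f' m' (k' + i') k'<k'+i')
      (≈-weaken (m+m≤n⇒m≤n h) ek , subst (λ z → j ∸ k ≈[ T' ] z) (sym (m+n∸m≡n k' i')) ei ,
       λ p → ≈-weaken (m+m≤n⇒m≤n h) (ef p)))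
    (similar-resp (dropˢ-> k f m j k<j) (dropˢ-> k' f' m' (k' + i') k'<k'+i')
      (≈-refl , subst₂ (λ a b → a ≈[ T' ] b) (sym ([k+m]∸j≡m∸[j∸k] m (<⇒≤ k<j)))
          (sym ([m+n]∸[m+o]≡n∸o k' m' i')) emi ,
       λ ()))
    where
      k'<k'+i' : k' < k' + i'
      k'<k'+i' = m<m+n k' (≈-pos 1≤T' ei (m<n⇒0<n∸m k<j))

  split-answer-pos : ∀ {T τ τ' j} → 1 ≤ T → (s : SplitAnswer T τ τ' j) → 1 ≤ j → j ≤ size τ → 1 ≤ SplitAnswer.j' s
  split-answer-pos {τ = τ} {τ'} h (splitAnswer j' j'≤size similar _) 1≤j j≤size =
    subst (1 ≤_) (size-takeˢ τ' j'≤size) (1≤size-similar h similar (subst (1 ≤_) (sym (size-takeˢ τ j≤size)) 1≤j))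

  split-answer<size : ∀ {T τ τ' j} → 1 ≤ T → (s : SplitAnswer T τ τ' j) → j < size τ → SplitAnswer.j' s < size τ'
  split-answer<size {τ = τ} {τ'} {j} h (splitAnswer j' _ _ similar) j<size = 1≤m∸n⇒n<m (subst (1 ≤_) (size-dropˢ τ' j')
    (1≤size-similar h similar (subst (1 ≤_) (sym (size-dropˢ τ j)) (m<n⇒0<n∸m j<size))))

  record Extensionʳ (T : ℕ) (τ₂ τ' : Shape) (L : ℕ) : Set where
    constructor extensionʳ
    field
      extended : Shape
      valid : Valid extended
      longer : size τ' < size extended
      takeˢ-extended : takeˢ extended (size τ') ≡ τ'
      similar-added : Similar T (dropˢ τ₂ L) (dropˢ extended (size τ'))

  extendʳ-labelled : ∀ {T T'} K F Mb k' f' m' → 1 ≤ T → Valid (shape k' f' m') → ∀ {L} → K < L → L < K + Mb →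
    Similar T (shape K F (L ∸ K)) (shape k' f' m') → Extensionʳ T' (shape K F Mb) (shape k' f' m') L
  extendʳ-labelled K F Mb k' f' m' 1≤T (_ , _ , vm') {L} K<L L<size (_ , em , _) =
    extensionʳ (shape k' 0 (m' + y)) valid (+-monoʳ-< k' (m<m+n m' 1≤y)) extended-prefix
      (similar-resp (dropˢ-> K F Mb L K<L) extended-suffix similar-refl)
    where
      y = (K + Mb) ∸ L
      1≤y : 1 ≤ y
      1≤y = m<n⇒0<n∸m L<size
      1≤m' : 1 ≤ m'
      1≤m' = ≈-pos 1≤T em (m<n⇒0<n∸m K<L)
      k'<k'+m' : k' < k' + m'
      k'<k'+m' = m<m+n k' 1≤m'
      valid : Valid (shape k' 0 (m' + y))
      valid = ≤-trans 1≤y (≤-trans (m≤n+m y m') (m≤n+m (m' + y) k')) , z≤n , λ _ → refl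
      extended-prefix : takeˢ (shape k' 0 (m' + y)) (k' + m') ≡ shape k' f' m'
      extended-prefix = trans (takeˢ-> k' 0 (m' + y) (k' + m') k'<k'+m')
                              (cong₂ (shape k') (sym (vm' 1≤m')) (m+n∸m≡n k' m'))
      extended-suffix : dropˢ (shape k' 0 (m' + y)) (k' + m') ≡ shape 0 0 y
      extended-suffix = trans (dropˢ-> k' 0 (m' + y) (k' + m') k'<k'+m')
        (cong (shape 0 0) (trans (cong (_∸ (k' + m')) (sym (+-assoc k' m' y))) (m+n∸m≡n (k' + m') y)))

  extendʳ-unlabelled : ∀ {T'} K F Mb k' f' {L} → L ≤ K → ∀ x F' M' → Valid (shape (k' + x) F' M') → 1 ≤ x + M' →
    (F' + x) ⊓ cap ≡ f' → Similar T' (shape (K ∸ L) F Mb) (shape x F' M') →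
    Extensionʳ T' (shape K F Mb) (shape k' f' 0) L
  extendʳ-unlabelled K F Mb k' f' {L} L≤K x F' M' v 1≤x+M' gap similar =
    extensionʳ (shape (k' + x) F' M') v longer extended-prefix
      (similar-resp (dropˢ-≤ K F Mb L L≤K) extended-suffix similar)
    where
      longer : k' + 0 < (k' + x) + M'
      longer = subst₂ _<_ (sym (+-identityʳ k')) (sym (+-assoc k' x M')) (m<m+n k' 1≤x+M')
      extended-prefix : takeˢ (shape (k' + x) F' M') (k' + 0) ≡ shape k' f' 0
      extended-prefix = trans (cong (takeˢ (shape (k' + x) F' M')) (+-identityʳ k'))
        (trans (takeˢ-≤ (k' + x) F' M' k' (m≤m+n k' x))
               (cong (λ g → shape k' g 0) (trans (cong (λ z → (F' + z) ⊓ cap) (m+n∸m≡n k' x)) gap)))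
      extended-suffix : dropˢ (shape (k' + x) F' M') (k' + 0) ≡ shape x F' M'
      extended-suffix = trans (cong (dropˢ (shape (k' + x) F' M')) (+-identityʳ k'))
        (trans (dropˢ-≤ (k' + x) F' M' k' (m≤m+n k' x)) (cong (λ z → shape z F' M') (m+n∸m≡n k' x)))

  extendʳ-copy : ∀ {T'} K F Mb k' {L} → L ≤ K → 1 ≤ k' → L < K + Mb → F ≤ cap → GapVanishes (shape K F Mb) →
    Extensionʳ T' (shape K F Mb) (shape k' ((F + (K ∸ L)) ⊓ cap) 0) L
  extendʳ-copy K F Mb k' {L} L≤K 1≤k' L<size F≤cap vm =
    extendʳ-unlabelled K F Mb k' _ L≤K (K ∸ L) F Mb
      (≤-trans 1≤k' (≤-trans (m≤m+n k' (K ∸ L)) (m≤m+n (k' + (K ∸ L)) Mb)) , F≤cap , vm)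
      (subst (1 ≤_) (+-∸-comm Mb L≤K) (m<n⇒0<n∸m L<size)) refl similar-refl

  extendʳ-to-goal : ∀ {T T'} K mb k' f' {L} → L ≤ K → T' ≤ T → T ≤ K ∸ L → T ≤ f' → f' ≤ cap →
    Extensionʳ T' (shape K 0 (suc mb)) (shape k' f' 0) L
  extendʳ-to-goal K mb k' f' L≤K T'≤T T≤y T≤f' f'≤cap =
    extendʳ-unlabelled K 0 (suc mb) k' f' L≤K f' 0 (suc mb)
      (≤-trans (s≤s z≤n) (m≤n+m (suc mb) (k' + f')) , z≤n , λ _ → refl)
      (≤-trans (s≤s z≤n) (m≤n+m (suc mb) f')) (m≤n⇒m⊓n≡m f'≤cap)
      (≈-large (≤-trans T'≤T T≤y) (≤-trans T'≤T T≤f') , ≈-refl , λ _ → ≈-refl)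

  extendʳ-shrink-gap : ∀ {T T'} K F k' f' {L} → L ≤ K → 1 ≤ T' → T' + T' ≤ T → 1 ≤ K ∸ L → T' ≤ F → T ≤ f' →
    f' ≤ cap → Extensionʳ T' (shape K F 0) (shape k' f' 0) L
  extendʳ-shrink-gap {T} {T'} K F k' f' {L} L≤K 1≤T' h 1≤y T'≤F T≤f' f'≤cap =
    extendʳ-unlabelled K F 0 k' f' L≤K y' (f' ∸ y') 0
      (≤-trans 1≤y' (≤-trans (m≤n+m y' k') (m≤m+n (k' + y') 0)) , ≤-trans (m∸n≤m f' y') f'≤cap , λ ())
      (subst (1 ≤_) (sym (+-identityʳ y')) 1≤y')
      (trans (cong (_⊓ cap) (m∸n+n≡m y'≤f')) (m≤n⇒m⊓n≡m f'≤cap))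
      (≈-⊓-threshold (K ∸ L) T' , ≈-refl , λ _ → ≈-large T'≤F (m+m≤n⇒m≤n∸o (≤-trans h T≤f') (m⊓n≤n (K ∸ L) T')))
    where
      y' = (K ∸ L) ⊓ T'
      1≤y' : 1 ≤ y'
      1≤y' = ⊓-glb 1≤y 1≤T'
      y'≤f' : y' ≤ f'
      y'≤f' = ≤-trans (m⊓n≤n (K ∸ L) T') (≤-trans (m+m≤n⇒m≤n h) T≤f')

  extendʳ-keep-gap : ∀ {T T'} K F k' f' {L} → L ≤ K → 1 ≤ T' → T' + T' ≤ T → F ≤ T' → T ≤ (F + (K ∸ L)) ⊓ cap →
    T ≤ f' → f' ≤ cap → Extensionʳ T' (shape K F 0) (shape k' f' 0) L
  extendʳ-keep-gap {T} {T'} K F k' f' {L} L≤K 1≤T' h F≤T' T≤g T≤f' f'≤cap =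
    extendʳ-unlabelled K F 0 k' f' L≤K x F 0
      (≤-trans (≤-trans 1≤T' T'≤x) (≤-trans (m≤n+m x k') (m≤m+n (k' + x) 0)) , ≤-trans F≤f' f'≤cap , λ ())
      (subst (1 ≤_) (sym (+-identityʳ x)) (≤-trans 1≤T' T'≤x))
      (trans (cong (_⊓ cap) (m+[n∸m]≡n F≤f')) (m≤n⇒m⊓n≡m f'≤cap))
      (≈-large T'≤y T'≤x , ≈-refl , λ _ → ≈-refl)
    where
      x = f' ∸ F
      F≤f' : F ≤ f'
      F≤f' = ≤-trans F≤T' (≤-trans (m+m≤n⇒m≤n h) T≤f')
      T'≤x : T' ≤ x
      T'≤x = m+m≤n⇒m≤n∸o (≤-trans h T≤f') F≤T'
      T'≤y : T' ≤ K ∸ L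
      T'≤y = +-cancelˡ-≤ T' T' (K ∸ L)
        (≤-trans h (≤-trans (≤-trans T≤g (m⊓n≤m (F + (K ∸ L)) cap)) (+-monoˡ-≤ (K ∸ L) F≤T')))

  extendʳ-large : ∀ {T T'} K F Mb k' f' {L} → L ≤ K → 1 ≤ T' → T' + T' ≤ T → L < K + Mb →
    GapVanishes (shape K F Mb) → T ≤ (F + (K ∸ L)) ⊓ cap → T ≤ f' → f' ≤ cap →
    Extensionʳ T' (shape K F Mb) (shape k' f' 0) L
  extendʳ-large K F (suc mb) k' f' L≤K 1≤T' h _ vm T≤g T≤f' f'≤cap with vm (s≤s z≤n)
  ... | refl = extendʳ-to-goal K mb k' f' L≤K (m+m≤n⇒m≤n h) (≤-trans T≤g (m⊓n≤m _ cap)) T≤f' f'≤cap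
  extendʳ-large {T} {T'} K F zero k' f' {L} L≤K 1≤T' h L<K _ T≤g T≤f' f'≤cap with T' ≤? F
  ... | yes T'≤F = extendʳ-shrink-gap K F k' f' L≤K 1≤T' h
                     (m<n⇒0<n∸m (subst (L <_) (+-identityʳ K) L<K)) T'≤F T≤f' f'≤cap
  ... | no T'≰F = extendʳ-keep-gap K F k' f' L≤K 1≤T' h (<⇒≤ (≰⇒> T'≰F)) T≤g T≤f' f'≤cap

  similar-extendʳ : ∀ {T T'} τ₂ τ' → 1 ≤ T' → T' + T' ≤ T → Valid τ₂ → ∀ {L} → 1 ≤ L → L < size τ₂ →
    Valid τ' → Similar T (takeˢ τ₂ L) τ' → Extensionʳ T' τ₂ τ' L
  similar-extendʳ (shape K F Mb) (shape k' f' m') 1≤T' h (_ , F≤cap , vm) {L} 1≤L L<size v'@(_ , f'≤cap , _) similar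
    with ≤-<-connex L K
  ... | inj₂ K<L = extendʳ-labelled K F Mb k' f' m' (≤-trans 1≤T' (m+m≤n⇒m≤n h)) v' K<L L<size
                     (similar-resp (sym (takeˢ-> K F Mb L K<L)) refl similar)
  ... | inj₁ L≤K with similar-resp (sym (takeˢ-≤ K F Mb L L≤K)) refl similar
  ... | ek , em , ef with ≈-zero (≤-trans 1≤T' (m+m≤n⇒m≤n h)) em refl | ef 1≤L
  ...   | refl | inj₁ refl = extendʳ-copy K F Mb k' L≤K (≈-pos (≤-trans 1≤T' (m+m≤n⇒m≤n h)) ek 1≤L) L<size F≤cap vm
  ...   | refl | inj₂ (T≤g , T≤f') = extendʳ-large K F Mb k' f' L≤K 1≤T' h L<size vm T≤g T≤f' f'≤cap

  similar-extended : ∀ {T T'} τ₂ τ' {L} → 1 ≤ T' → T' ≤ T → Valid τ₂ → L ≤ size τ₂ → Similar T (takeˢ τ₂ L) τ' →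
    (e : Extensionʳ T' τ₂ τ' L) → Similar T' τ₂ (Extensionʳ.extended e)
  similar-extended τ₂ τ' {L} 1≤T' T'≤T v L≤size similar (extensionʳ τ₂' v' longer prefix added) =
    similar-resp (takeˢ++dropˢ τ₂ v L≤size)
        (trans (takeˢ++dropˢ τ₂' v' (<⇒≤ longer)) (cong (_++ˢ dropˢ τ₂' (size τ')) prefix))
      (similar-++ˢ 1≤T' (similar-weaken T'≤T similar) added
        (GapVanishes-dropˢ τ₂ L (proj₂ (proj₂ v))) (GapVanishes-dropˢ τ₂' (size τ') (proj₂ (proj₂ v'))))

  record Extensionˡ (T : ℕ) (τ₂ τ' : Shape) : Set where
    constructor extensionˡ
    field
      extended : Shape
      added : ℕ
      valid : Valid extended
      1≤added : 1 ≤ added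
      added<size : added < size extended
      dropˢ-extended : dropˢ extended added ≡ τ'
      similar-whole : Similar T τ₂ extended

  extendˡ-labelled : ∀ {T} K F Mb k' f' m' {j} → 1 ≤ T → GapVanishes (shape K F Mb) → Valid (shape k' f' m') →
    1 ≤ j → K < j → j < K + Mb → Similar T (shape 0 0 ((K + Mb) ∸ j)) (shape k' f' m') →
    Extensionˡ T (shape K F Mb) (shape k' f' m')
  extendˡ-labelled {T} K F Mb k' f' m' {j} 1≤T vm (_ , _ , vm') 1≤j K<j j<size (ek , em , _) with ≈-zero 1≤T ek refl
  ... | refl = extensionˡ (shape K 0 ((j ∸ K) + m')) j valid 1≤j j<size' dropped
      (≈-refl , subst (λ z → z ≈[ T ] (j ∸ K) + m') (sym (m≡[j∸k]+[k+m∸j] (<⇒≤ K<j) (<⇒≤ j<size))) (≈-c+ (j ∸ K) em) ,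
       λ _ → inj₁ (vm (k<j≤k+m⇒1≤m K<j (<⇒≤ j<size))))
    where
      1≤m' : 1 ≤ m'
      1≤m' = ≈-pos 1≤T em (m<n⇒0<n∸m j<size)
      valid : Valid (shape K 0 ((j ∸ K) + m'))
      valid = ≤-trans 1≤m' (≤-trans (m≤n+m m' (j ∸ K)) (m≤n+m _ K)) , z≤n , λ _ → refl
      size≡ : K + ((j ∸ K) + m') ≡ j + m'
      size≡ = trans (sym (+-assoc K (j ∸ K) m')) (cong (_+ m') (m+[n∸m]≡n (<⇒≤ K<j)))
      j<size' : j < K + ((j ∸ K) + m')
      j<size' = subst (j <_) (sym size≡) (m<m+n j 1≤m')
      dropped : dropˢ (shape K 0 ((j ∸ K) + m')) j ≡ shape 0 f' m'
      dropped = trans (dropˢ-> K 0 ((j ∸ K) + m') j K<j)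
        (cong₂ (shape 0) (sym (vm' 1≤m')) (trans (cong (_∸ j) size≡) (m+n∸m≡n j m')))

  extendˡ-unlabelled : ∀ {T} K F Mb τ' {j} → 1 ≤ T → Valid τ' → 1 ≤ j → j ≤ K → 1 ≤ K ∸ j →
    Similar T (shape (K ∸ j) F Mb) τ' → Extensionˡ T (shape K F Mb) τ'
  extendˡ-unlabelled {T} K F Mb (shape k' f' m') {j} 1≤T (_ , f'≤cap , vm') 1≤j j≤K 1≤K∸j (ek , em , ef) =
    extensionˡ (shape (k' + j) f' m') j valid 1≤j (≤-trans (+-monoˡ-≤ j 1≤k') (m≤m+n (k' + j) m'))
      (trans (dropˢ-≤ (k' + j) f' m' j (m≤n+m j k')) (cong (λ z → shape z f' m') (m+n∸n≡m k' j)))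
      (subst (λ z → z ≈[ T ] k' + j) (m∸n+n≡m j≤K) (≈-+c j ek) , em , λ _ → ef 1≤K∸j)
    where
      1≤k' : 1 ≤ k'
      1≤k' = ≈-pos 1≤T ek 1≤K∸j
      valid : Valid (shape (k' + j) f' m')
      valid = ≤-trans (≤-trans 1≤k' (m≤m+n k' j)) (m≤m+n _ m') , f'≤cap , vm'

  extendˡ-onto-goal : ∀ {T} K F Mb k' f' m' → 1 ≤ T → GapVanishes (shape K F Mb) → Valid (shape k' f' m') →
    1 ≤ K → K < K + Mb → Similar T (shape (K ∸ K) F Mb) (shape k' f' m') →
    Extensionˡ T (shape K F Mb) (shape k' f' m')
  extendˡ-onto-goal K F Mb k' f' m' 1≤T vm (_ , _ , vm') 1≤K K<size (ek , em , _) with ≈-zero 1≤T ek (n∸n≡0 K)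
  ... | refl = extensionˡ (shape K 0 m') K (≤-trans 1≤m' (m≤n+m m' K) , z≤n , λ _ → refl) 1≤K (m<m+n K 1≤m')
      (trans (dropˢ-≤ K 0 m' K ≤-refl) (cong₂ (λ a b → shape a b m') (n∸n≡0 K) (sym (vm' 1≤m'))))
      (≈-refl , em , λ _ → inj₁ (vm 1≤Mb))
    where
      1≤Mb : 1 ≤ Mb
      1≤Mb = k<j≤k+m⇒1≤m (n<1+n K) K<size
      1≤m' : 1 ≤ m'
      1≤m' = ≈-pos 1≤T em 1≤Mb

  similar-extendˡ : ∀ {T} τ₂ τ' → 1 ≤ T → Valid τ₂ → ∀ {j} → 1 ≤ j → j < size τ₂ → Valid τ' →
    Similar T (dropˢ τ₂ j) τ' → Extensionˡ T τ₂ τ'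
  similar-extendˡ (shape K F Mb) (shape k' f' m') 1≤T (_ , _ , vm) {j} 1≤j j<size v' similar with ≤-<-connex j K
  ... | inj₂ K<j = extendˡ-labelled K F Mb k' f' m' 1≤T vm v' 1≤j K<j j<size
                     (similar-resp (sym (dropˢ-> K F Mb j K<j)) refl similar)
  ... | inj₁ j≤K with ≤-<-connex 1 (K ∸ j)
  ...   | inj₁ 1≤K∸j = extendˡ-unlabelled K F Mb (shape k' f' m') 1≤T v' 1≤j j≤K 1≤K∸j
                         (similar-resp (sym (dropˢ-≤ K F Mb j j≤K)) refl similar)
  ...   | inj₂ K∸j<1 with ≤-antisym j≤K (m∸n≡0⇒m≤n (n<1⇒n≡0 K∸j<1))
  ...     | refl = extendˡ-onto-goal K F Mb k' f' m' 1≤T vm v' 1≤j j<size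
                     (similar-resp (sym (dropˢ-≤ K F Mb K ≤-refl)) refl similar)

  -- A trace of shape τ with 1 ≤ k τ starts at the first chain state when f τ + k τ ≡ cap,
  -- and in the unlabelled loop when cap < f τ + k τ.
  record ChainStart (T : ℕ) (τ : Shape) : Set where
    constructor chainStart
    field
      started : Shape
      valid : Valid started
      1≤k : 1 ≤ k started
      f+k≡cap : f started + k started ≡ cap
      similar : Similar T τ started

  similar-start : ∀ {T} τ → 1 ≤ T → T + T ≤ cap → Valid τ → 1 ≤ k τ → cap < f τ + k τ → ChainStart T τ
  similar-start {T} (shape k f (suc m)) 1≤T h (_ , _ , vm) _ cap<f+k with vm (s≤s z≤n)
  ... | refl = chainStart (shape cap 0 (suc m)) (≤-trans (s≤s z≤n) (m≤n+m (suc m) cap) , z≤n , λ _ → refl)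
      (≤-trans 1≤T (m+m≤n⇒m≤n h)) refl
          (≈-large (≤-trans (m+m≤n⇒m≤n h) (<⇒≤ cap<f+k)) (m+m≤n⇒m≤n h) , ≈-refl , λ _ → ≈-refl)
  similar-start {T} (shape k f zero) 1≤T h (_ , f≤cap , _) 1≤k cap<f+k with T ≤? f
  ... | yes T≤f = chainStart (shape k₀ (cap ∸ k₀) 0) (subst (1 ≤_) (sym (+-identityʳ k₀)) 1≤k₀ , m∸n≤m cap k₀ , λ ())
      1≤k₀ (m∸n+n≡m (≤-trans (m⊓n≤n k T) (m+m≤n⇒m≤n h)))
      (≈-⊓-threshold k T , ≈-refl , λ _ → ≈-large T≤f (m+m≤n⇒m≤n∸o h (m⊓n≤n k T)))
    where
      k₀ = k ⊓ T
      1≤k₀ : 1 ≤ k₀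
      1≤k₀ = ⊓-glb 1≤k 1≤T
  ... | no T≰f = chainStart (shape (cap ∸ f) f 0) (subst (1 ≤_) (sym (+-identityʳ _)) 1≤cap∸f , f≤cap , λ ())
      1≤cap∸f (m+[n∸m]≡n f≤cap) (≈-large T≤k T≤cap∸f , ≈-refl , λ _ → ≈-refl)
    where
      T≤cap∸f : T ≤ cap ∸ f
      T≤cap∸f = m+m≤n⇒m≤n∸o h (<⇒≤ (≰⇒> T≰f))
      1≤cap∸f : 1 ≤ cap ∸ f
      1≤cap∸f = ≤-trans 1≤T T≤cap∸f
      T≤k : T ≤ k
      T≤k = ≤-trans T≤cap∸f (subst (cap ∸ f ≤_) (m+n∸m≡n f k) (∸-monoˡ-≤ f (<⇒≤ cap<f+k)))

-- State 0 is the unlabelled loop, states 1, …, cap form the unlabelled chain, and the last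
-- state, cap + 1, is the labelled loop at its end (the goal). The loop at 0 may also leave to 1.
module Chain (N : ℕ) where

  cap : ℕ
  cap = suc N

  open Shapes cap

  State : Set
  State = Fin (suc (suc cap))

  step? : ℕ → ℕ → Bool
  step? zero j = j ≤ᵇ 1
  step? (suc i) j = j ≡ᵇ (suc (suc i) ⊓ suc cap)

  Step : State → State → Set
  Step s t = T (step? (toℕ s) (toℕ t))

  state : ℕ → State
  state p = fromℕ< {p ⊓ suc cap} (s≤s (m⊓n≤n p (suc cap)))

  toℕ-state : ∀ p → toℕ (state p) ≡ p ⊓ suc cap
  toℕ-state p = toℕ-fromℕ< (s≤s (m⊓n≤n p (suc cap)))

  goal : State
  goal = state (suc cap)

  idle : State
  idle = zero

  start : State
  start = state 1

  toℕ-goal : toℕ goal ≡ suc cap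
  toℕ-goal = trans (toℕ-state (suc cap)) (⊓-idem (suc cap))

  toℕ≤suc-cap : ∀ (s : State) → toℕ s ≤ suc cap
  toℕ≤suc-cap s = ≤-pred (toℕ<n s)

  state-toℕ : ∀ (s : State) → s ≡ state (toℕ s)
  state-toℕ s = toℕ-injective (sym (trans (toℕ-state (toℕ s)) (m≤n⇒m⊓n≡m (toℕ≤suc-cap s))))

  toℕ-state-≤cap : ∀ {p} → p ≤ cap → toℕ (state p) ≡ p
  toℕ-state-≤cap p≤cap = trans (toℕ-state _) (m≤n⇒m⊓n≡m (≤-trans p≤cap (n≤1+n cap)))

  state-goal : ∀ {p} → suc cap ≤ p → state p ≡ goal
  state-goal le = toℕ-injective (trans (toℕ-state _) (trans (m≥n⇒m⊓n≡n le) (sym toℕ-goal)))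

  chain : State → FinKripke 1
  chain s₀ = record
    { m = suc (suc cap)
    ; δ = λ s t → step? (toℕ s) (toℕ t)
    ; total = total
    ; μ = λ s → (toℕ s ≡ᵇ suc cap) ∷ []
    ; s₀ = s₀ }
    where
      total : (s : State) → ∃ λ t → Step s t
      total zero = zero , _
      total (suc s) = state (suc (suc (toℕ s))) , ≡⇒≡ᵇ _ _ (toℕ-state (suc (suc (toℕ s))))

  -- The last L states of the run reaching position t, positions beyond the goal being the goal.
  run : ℕ → ℕ → List State
  run t zero = []
  run t (suc L) = run (pred t) L ∷ʳ state t

  run-+ : ∀ t L₁ L₂ → run t (L₁ + L₂) ≡ run (t ∸ L₂) L₁ ++ run t L₂
  run-+ t L₁ zero rewrite +-identityʳ L₁ = sym (++-identityʳ _)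
  run-+ t L₁ (suc L₂) rewrite +-suc L₁ L₂ | run-+ (pred t) L₁ L₂ | ∸-+-assoc t 1 L₂ =
    ++-assoc (run (t ∸ suc L₂) L₁) (run (pred t) L₂) (state t ∷ [])

  run-suc : ∀ t L → run t (suc L) ≡ state (t ∸ L) ∷ run t L
  run-suc t L = run-+ t 1 L

  length-run : ∀ t L → length (run t L) ≡ L
  length-run t zero = refl
  length-run t (suc L) rewrite length-++ (run (pred t) L) {state t ∷ []} | length-run (pred t) L = +-comm L 1

  suc-⊓-cap : ∀ y → suc y ⊓ cap ≡ suc (y ⊓ cap) ⊓ cap
  suc-⊓-cap y with ≤-total y cap
  ... | inj₁ le rewrite m≤n⇒m⊓n≡m le = refl
  ... | inj₂ ge rewrite m≥n⇒m⊓n≡n ge | m≥n⇒m⊓n≡n (≤-trans ge (n≤1+n y)) | m≥n⇒m⊓n≡n (n≤1+n cap) = refl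

  Step-pred : ∀ p → Step (state (pred p)) (state p)
  Step-pred p = subst₂ (λ a b → T (step? a b)) (sym (toℕ-state (pred p))) (sym (toℕ-state p)) (step?-pred p)
    where
      step?-pred : ∀ p → T (step? (pred p ⊓ suc cap) (p ⊓ suc cap))
      step?-pred zero = _
      step?-pred (suc zero) = _
      step?-pred (suc (suc y)) = ≡⇒≡ᵇ _ _ (cong suc (suc-⊓-cap y))

  Linked-run : ∀ t L → Linked Step (run t L)
  Linked-run t zero = []
  Linked-run t (suc zero) = [-]
  Linked-run t (suc (suc L)) = subst (Linked Step) (sym (run-suc t (suc L))) (extend (Linked-run t (suc L)))
    where
      extend : Linked Step (run t (suc L)) → Linked Step (state (t ∸ suc L) ∷ run t (suc L))
      extend l rewrite run-suc t L =
        subst (λ z → Step (state z) (state (t ∸ L))) (pred[m∸n]≡m∸[1+n] t L) (Step-pred (t ∸ L)) ∷ l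

  replicate-∷ʳ : ∀ {A : Set} L (x : A) → replicate L x ∷ʳ x ≡ replicate (suc L) x
  replicate-∷ʳ zero x = refl
  replicate-∷ʳ (suc L) x = cong (x ∷_) (replicate-∷ʳ L x)

  run-goal : ∀ t L → cap + L ≤ t → run t L ≡ replicate L goal
  run-goal t zero _ = refl
  run-goal t (suc L) le rewrite run-goal (pred t) L (suc[m]≤n⇒m≤pred[n] (subst (_≤ t) (+-suc cap L) le))
    | state-goal (≤-trans (s≤s (m≤m+n cap L)) (subst (_≤ t) (+-suc cap L) le)) = replicate-∷ʳ L goal

  isGoal : State → ℕ
  isGoal s with toℕ s ≟ suc cap
  ... | yes _ = 1
  ... | no _ = 0

  #goals : List State → ℕ
  #goals [] = 0
  #goals (s ∷ xs) = isGoal s + #goals xs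

  #goals-++ : ∀ xs ys → #goals (xs ++ ys) ≡ #goals xs + #goals ys
  #goals-++ [] ys = refl
  #goals-++ (x ∷ xs) ys rewrite #goals-++ xs ys = sym (+-assoc (isGoal x) (#goals xs) (#goals ys))

  #goals-replicate : ∀ L → #goals (replicate L goal) ≡ L
  #goals-replicate zero = refl
  #goals-replicate (suc L) with toℕ goal ≟ suc cap
  ... | yes _ = cong suc (#goals-replicate L)
  ... | no ≢ = ⊥-elim (≢ toℕ-goal)

  #goals-run : ∀ t L → t ≤ cap → #goals (run t L) ≡ 0
  #goals-run t zero _ = refl
  #goals-run t (suc L) le
    rewrite #goals-++ (run (pred t) L) (state t ∷ []) | #goals-run (pred t) L (≤-trans pred[n]≤n le)
    with toℕ (state t) ≟ suc cap
  ... | no _ = refl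
  ... | yes e = ⊥-elim (<⇒≱ (s≤s le) (≤-reflexive (trans (sym e) (toℕ-state-≤cap le))))

  lastIndex : List State → ℕ
  lastIndex [] = suc cap
  lastIndex (x ∷ []) = toℕ x
  lastIndex (x ∷ y ∷ xs) = lastIndex (y ∷ xs)

  lastIndex-∷ʳ : ∀ xs x → lastIndex (xs ∷ʳ x) ≡ toℕ x
  lastIndex-∷ʳ [] x = refl
  lastIndex-∷ʳ (y ∷ []) x = refl
  lastIndex-∷ʳ (y ∷ z ∷ xs) x = lastIndex-∷ʳ (z ∷ xs) x

  lastIndex-run : ∀ t L → 1 ≤ L → lastIndex (run t L) ≡ t ⊓ suc cap
  lastIndex-run t (suc L) _ = trans (lastIndex-∷ʳ (run (pred t) L) (state t)) (toℕ-state t)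

  shapeOf : List State → Shape
  shapeOf ρ = shape (length ρ ∸ #goals ρ) (cap ∸ lastIndex ρ) (#goals ρ)

  endpoint : Shape → ℕ
  endpoint τ = (cap ∸ f τ) + m τ

  trace : Shape → List State
  trace τ = run (endpoint τ) (size τ)

  length-trace : ∀ τ → length (trace τ) ≡ size τ
  length-trace τ = length-run (endpoint τ) (size τ)

  Linked-trace : ∀ τ → Linked Step (trace τ)
  Linked-trace τ = Linked-run (endpoint τ) (size τ)

  shapeOf-trace : ∀ τ → Valid τ → shapeOf (trace τ) ≡ τ
  shapeOf-trace (shape k f zero) (1≤size , f≤cap , _) = shape-cong k≡ f≡ no-goals
    where
      t = (cap ∸ f) + 0
      t≤cap : t ≤ cap
      t≤cap = subst (_≤ cap) (sym (+-identityʳ (cap ∸ f))) (m∸n≤m cap f)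
      no-goals : #goals (run t (k + 0)) ≡ 0
      no-goals = #goals-run t (k + 0) t≤cap
      k≡ : length (run t (k + 0)) ∸ #goals (run t (k + 0)) ≡ k
      k≡ rewrite no-goals | length-run t (k + 0) = +-identityʳ k
      f≡ : cap ∸ lastIndex (run t (k + 0)) ≡ f
      f≡ rewrite lastIndex-run t (k + 0) 1≤size | m≤n⇒m⊓n≡m (≤-trans t≤cap (n≤1+n cap)) | +-identityʳ (cap ∸ f) =
        m∸[m∸n]≡n f≤cap
  shapeOf-trace (shape k f (suc m)) (1≤size , _ , vm) with vm (s≤s z≤n)
  ... | refl = shape-cong k≡ f≡ goals
    where
      t = cap + suc m
      goals : #goals (run t (k + suc m)) ≡ suc m
      goals rewrite run-+ t k (suc m) | m+n∸n≡m cap (suc m) | #goals-++ (run cap k) (run t (suc m))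
                  | #goals-run cap k ≤-refl | run-goal t (suc m) ≤-refl = #goals-replicate (suc m)
      k≡ : length (run t (k + suc m)) ∸ #goals (run t (k + suc m)) ≡ k
      k≡ rewrite goals | length-run t (k + suc m) = m+n∸n≡m k (suc m)
      f≡ : cap ∸ lastIndex (run t (k + suc m)) ≡ 0
      f≡ = m≤n⇒m∸n≡0 (subst (cap ≤_) (sym (lastIndex-run t (k + suc m) 1≤size))
          (⊓-glb (m≤m+n cap (suc m)) (n≤1+n cap)))

  trace-injective : ∀ τ σ → Valid τ → Valid σ → trace τ ≡ trace σ → τ ≡ σ
  trace-injective τ σ vτ vσ e = trans (sym (shapeOf-trace τ vτ)) (trans (cong shapeOf e) (shapeOf-trace σ vσ))

  cap∸x≡cap∸[x⊓cap] : ∀ x → cap ∸ x ≡ cap ∸ (x ⊓ cap)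
  cap∸x≡cap∸[x⊓cap] x with ≤-total x cap
  ... | inj₁ le rewrite m≤n⇒m⊓n≡m le = refl
  ... | inj₂ ge rewrite m≥n⇒m⊓n≡n ge | n∸n≡0 cap = m≤n⇒m∸n≡0 ge

  run-takeˢ : ∀ τ j → Valid τ → j ≤ size τ → run (endpoint τ ∸ (size τ ∸ j)) j ≡ trace (takeˢ τ j)
  run-takeˢ (shape k f m) j _ le with ≤-<-connex j k
  ... | inj₁ j≤k rewrite takeˢ-≤ k f m j j≤k = cong₂ run endpoint≡ (sym (+-identityʳ j))
    where
      endpoint≡ : ((cap ∸ f) + m) ∸ ((k + m) ∸ j) ≡ (cap ∸ ((f + (k ∸ j)) ⊓ cap)) + 0
      endpoint≡ rewrite +-∸-comm m j≤k | [m+o]∸[n+o]≡m∸n (cap ∸ f) (k ∸ j) m | ∸-+-assoc cap f (k ∸ j)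
                      | +-identityʳ (cap ∸ ((f + (k ∸ j)) ⊓ cap)) = cap∸x≡cap∸[x⊓cap] (f + (k ∸ j))
  ... | inj₂ k<j rewrite takeˢ-> k f m j k<j = cong₂ run endpoint≡ (sym (m+[n∸m]≡n (<⇒≤ k<j)))
    where
      j∸k≤m : j ∸ k ≤ m
      j∸k≤m = subst (j ∸ k ≤_) (m+n∸m≡n k m) (∸-monoˡ-≤ k le)
      endpoint≡ : ((cap ∸ f) + m) ∸ ((k + m) ∸ j) ≡ (cap ∸ f) + (j ∸ k)
      endpoint≡ rewrite [k+m]∸j≡m∸[j∸k] m (<⇒≤ k<j) | +-∸-assoc (cap ∸ f) (m∸n≤m m (j ∸ k)) | m∸[m∸n]≡n j∸k≤m = refl

  run-dropˢ : ∀ τ j → Valid τ → j ≤ size τ → run (endpoint τ) (size τ ∸ j) ≡ trace (dropˢ τ j)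
  run-dropˢ (shape k f m) j (_ , _ , vm) le with ≤-<-connex j k
  ... | inj₁ j≤k rewrite dropˢ-≤ k f m j j≤k = cong (run (endpoint (shape k f m))) (+-∸-comm m j≤k)
  ... | inj₂ k<j rewrite dropˢ-> k f m j k<j | vm (k<j≤k+m⇒1≤m k<j le) =
    trans (run-goal ((cap ∸ 0) + m) r
        (+-monoʳ-≤ cap (subst (_≤ m) (sym ([k+m]∸j≡m∸[j∸k] m (<⇒≤ k<j))) (m∸n≤m m (j ∸ k)))))
          (sym (run-goal (cap + r) r ≤-refl))
    where
      r = (k + m) ∸ j

  trace-++ : ∀ τ j → Valid τ → j ≤ size τ → trace τ ≡ trace (takeˢ τ j) ++ trace (dropˢ τ j)
  trace-++ τ j v le = begin
    run t (size τ)                           ≡⟨ cong (run t) (sym (m+[n∸m]≡n le)) ⟩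
    run t (j + r)                            ≡⟨ run-+ t j r ⟩
    run (t ∸ r) j ++ run t r                 ≡⟨ cong₂ _++_ (run-takeˢ τ j v le) (run-dropˢ τ j v le) ⟩
    trace (takeˢ τ j) ++ trace (dropˢ τ j)   ∎
    where
      open ≡-Reasoning
      t = endpoint τ
      r = size τ ∸ j

  trace-split : ∀ τ α β → Valid τ → α ++ β ≡ trace τ →
    α ≡ trace (takeˢ τ (length α)) × β ≡ trace (dropˢ τ (length α))
  trace-split τ α β v e = ++-injective-length α β (trace (takeˢ τ j)) (trace (dropˢ τ j))
      (trans e (trace-++ τ j v j≤size))
    (sym (trans (length-trace (takeˢ τ j)) (size-takeˢ τ j≤size)))
    where
      j = length α
      j≤size : j ≤ size τ
      j≤size = subst (j ≤_) (trans (sym (length-++ α)) (trans (cong length e) (length-trace τ))) (m≤m+n j (length β))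

  step?⇒pred : ∀ i h → T (step? i h) → h ≤ cap → i ≡ pred h
  step?⇒pred zero h t le with ≤ᵇ⇒≤ h 1 t
  ... | z≤n = refl
  ... | s≤s z≤n = refl
  step?⇒pred (suc i) h t le with ≤-total (suc i) cap
  ... | inj₁ i<cap rewrite m≤n⇒m⊓n≡m i<cap | ≡ᵇ⇒≡ h (suc (suc i)) t = refl
  ... | inj₂ cap≤i rewrite m≥n⇒m⊓n≡n cap≤i | ≡ᵇ⇒≡ h (suc cap) t = ⊥-elim (<⇒≱ (n<1+n cap) le)

  step?-goal⇒ : ∀ i → i ≤ suc cap → T (step? i (suc cap)) → i ≡ cap ⊎ i ≡ suc cap
  step?-goal⇒ zero _ ()
  step?-goal⇒ (suc i) le t with m≤n⇒m<n∨m≡n cap≤suc-i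
    where
      cap≤suc-i : cap ≤ suc i
      cap≤suc-i = s≤s (subst (_≤ i) (sym (≡ᵇ⇒≡ N (i ⊓ N) t)) (m⊓n≤m i N))
  ... | inj₂ e = inj₁ (sym e)
  ... | inj₁ lt = inj₂ (≤-antisym le lt)

  Labelled : State → Set
  Labelled s = zero ∈ ((toℕ s ≡ᵇ suc cap) ∷ [])

  Labelled⇒toℕ≡suc-cap : ∀ {s} → Labelled s → toℕ s ≡ suc cap
  Labelled⇒toℕ≡suc-cap l = ≡ᵇ⇒≡ _ _ (∈-singleton⇒T l)

  toℕ≡suc-cap⇒Labelled : ∀ {s} → toℕ s ≡ suc cap → Labelled s
  toℕ≡suc-cap⇒Labelled e = T⇒∈-singleton (≡⇒≡ᵇ _ _ e)

  trace-unlabelled-head : ∀ k' f m →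
    trace (shape (suc k') f m) ≡ state ((cap ∸ f) ∸ k') ∷ run (endpoint (shape (suc k') f m)) (k' + m)
  trace-unlabelled-head k' f m =
    trans (run-suc _ (k' + m)) (cong (λ z → state z ∷ run t (k' + m)) ([m+o]∸[n+o]≡m∸n (cap ∸ f) k' m))
    where t = endpoint (shape (suc k') f m)

  head-index≤cap : ∀ k' f → (cap ∸ f) ∸ k' ≤ cap
  head-index≤cap k' f = ≤-trans (m∸n≤m (cap ∸ f) k') (m∸n≤m cap f)

  All-Labelled⇒k≡0 : ∀ τ → All Labelled (trace τ) → k τ ≡ 0
  All-Labelled⇒k≡0 (shape zero f m) _ = refl
  All-Labelled⇒k≡0 (shape (suc k') f m) a with subst (All Labelled) (trace-unlabelled-head k' f m) a
  ... | l ∷ _ = ⊥-elim (<⇒≱ (s≤s (head-index≤cap k' f))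
                  (≤-reflexive (trans (sym (Labelled⇒toℕ≡suc-cap l)) (toℕ-state-≤cap (head-index≤cap k' f)))))

  k≡0⇒All-Labelled : ∀ τ → Valid τ → k τ ≡ 0 → All Labelled (trace τ)
  k≡0⇒All-Labelled (shape zero f zero) (() , _) refl
  k≡0⇒All-Labelled (shape zero f (suc m)) (_ , _ , vm) refl with vm (s≤s z≤n)
  ... | refl = subst (All Labelled) (sym (run-goal (cap + suc m) (suc m) ≤-refl))
                 (Allₚ.replicate⁺ (suc m) (toℕ≡suc-cap⇒Labelled toℕ-goal))

  idle-first : ∀ τ xs → Valid τ → idle ∷ xs ≡ trace τ → 1 ≤ k τ × cap < f τ + k τ
  idle-first (shape zero f zero) xs (() , _) e
  idle-first (shape zero f (suc m)) xs (_ , _ , vm) e with vm (s≤s z≤n)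
  ... | refl = ⊥-elim (0≢1+n (trans (cong toℕ (proj₁ (∷-injective idle≡goal))) toℕ-goal))
    where
      idle≡goal : idle ∷ xs ≡ goal ∷ replicate m goal
      idle≡goal = trans e (run-goal (cap + suc m) (suc m) ≤-refl)
  idle-first (shape (suc k') f m) xs _ e = s≤s z≤n , subst (cap <_) (sym (+-suc f k'))
    (s≤s (≤-trans (m≤n+m∸n cap f) (+-monoʳ-≤ f (m∸n≡0⇒m≤n index≡0))))
    where
      index≡0 : (cap ∸ f) ∸ k' ≡ 0
      index≡0 = sym (trans (cong toℕ (proj₁ (∷-injective (trans e (trace-unlabelled-head k' f m)))))
                           (toℕ-state-≤cap (head-index≤cap k' f)))

  start-first : ∀ τ → 1 ≤ k τ → f τ + k τ ≡ cap → Σ (List State) λ ys → trace τ ≡ start ∷ ys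
  start-first (shape (suc k') f m) _ e =
    _ , trans (trace-unlabelled-head k' f m)
        (cong (λ z → state z ∷ run (endpoint (shape (suc k') f m)) (k' + m)) index≡1)
    where
      index≡1 : (cap ∸ f) ∸ k' ≡ 1
      index≡1 = trans (cong (λ z → (z ∸ f) ∸ k') (sym e)) (trans (cong (_∸ k') (m+n∸m≡n f (suc k'))) (m+n∸n≡m 1 k'))

  Traced : List State → Set
  Traced ρ = Σ Shape λ τ → Valid τ × ρ ≡ trace τ

  trace-∷-unlabelled : ∀ s k' f m s' ρ → Valid (shape (suc k') f m) → s' ∷ ρ ≡ trace (shape (suc k') f m) →
    Step s s' → Traced (s ∷ s' ∷ ρ)
  trace-∷-unlabelled s k' f m s' ρ (_ , f≤cap , vm) e step =
    shape (suc (suc k')) f m , (s≤s z≤n , f≤cap , vm) , trans (cong₂ _∷_ s≡ e) (sym (run-suc t (suc k' + m)))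
    where
      t = (cap ∸ f) + m
      h = t ∸ (k' + m)
      h≤cap : h ≤ cap
      h≤cap = subst (_≤ cap) (sym ([m+o]∸[n+o]≡m∸n (cap ∸ f) k' m)) (≤-trans (m∸n≤m (cap ∸ f) k') (m∸n≤m cap f))
      toℕ-s' : toℕ s' ≡ h
      toℕ-s' = trans (cong toℕ (proj₁ (∷-injective (trans e (run-suc t (k' + m)))))) (toℕ-state-≤cap h≤cap)
      toℕ-s : toℕ s ≡ pred h
      toℕ-s = step?⇒pred (toℕ s) h (subst (λ z → T (step? (toℕ s) z)) toℕ-s' step) h≤cap
      s≡ : s ≡ state (t ∸ suc (k' + m))
      s≡ = toℕ-injective (trans toℕ-s (trans (pred[m∸n]≡m∸[1+n] t (k' + m))
             (sym (toℕ-state-≤cap (subst (_≤ cap) (pred[m∸n]≡m∸[1+n] t (k' + m)) (≤-trans pred[n]≤n h≤cap))))))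

  trace-∷-labelled : ∀ s m' s' ρ → s' ∷ ρ ≡ trace (shape 0 0 (suc m')) → Step s s' → Traced (s ∷ s' ∷ ρ)
  trace-∷-labelled s m' s' ρ e step with step?-goal⇒ (toℕ s) (toℕ≤suc-cap s) step-goal
    where
      goals : s' ∷ ρ ≡ goal ∷ replicate m' goal
      goals = trans e (run-goal (cap + suc m') (suc m') ≤-refl)
      step-goal : T (step? (toℕ s) (suc cap))
      step-goal = subst (λ z → T (step? (toℕ s) z)) (trans (cong toℕ (proj₁ (∷-injective goals))) toℕ-goal) step
  ... | inj₁ s≡cap = shape 1 0 (suc m') , (s≤s z≤n , z≤n , λ _ → refl) ,
    trans (cong₂ _∷_ (trans (state-toℕ s) (cong state (trans s≡cap (sym (m+n∸n≡m cap (suc m')))))) e)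
          (sym (run-suc (cap + suc m') (suc m')))
  ... | inj₂ s≡goal = shape 0 0 (suc (suc m')) , (s≤s z≤n , z≤n , λ _ → refl) ,
    trans (cong₂ _∷_ (trans (state-toℕ s) (cong state s≡goal)) (trans e (run-goal (cap + suc m') (suc m') ≤-refl)))
          (sym (run-goal (cap + suc (suc m')) (suc (suc m')) ≤-refl))

  trace-shape : ∀ ρ → Linked Step ρ → ρ ≢ [] → Traced ρ
  trace-shape [] _ ne = ⊥-elim (ne refl)
  trace-shape (s ∷ []) _ _ with ≤-<-connex (toℕ s) cap
  ... | inj₁ s≤cap = shape 1 (cap ∸ toℕ s) 0 , (s≤s z≤n , m∸n≤m cap (toℕ s) , λ ()) ,
        cong (_∷ []) (trans (state-toℕ s) (cong state (sym (trans (+-identityʳ _) (m∸[m∸n]≡n s≤cap)))))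
  ... | inj₂ cap<s = shape 0 0 1 , (s≤s z≤n , z≤n , λ _ → refl) ,
        cong (_∷ []) (trans (state-toℕ s) (cong state (trans (≤-antisym (toℕ≤suc-cap s) cap<s) (sym (+-comm cap 1)))))
  trace-shape (s ∷ s' ∷ ρ) (step ∷ l) _ with trace-shape (s' ∷ ρ) l (λ ())
  ... | shape (suc k') f m , v , e = trace-∷-unlabelled s k' f m s' ρ v e step
  ... | shape zero f zero , (() , _) , _
  ... | shape zero f (suc m') , (_ , _ , vm) , e with vm (s≤s z≤n)
  ...   | refl = trace-∷-labelled s m' s' ρ e step

  trace≢[] : ∀ τ → 1 ≤ size τ → trace τ ≢ []
  trace≢[] τ p = 1≤length⇒≢[] (trace τ) (subst (1 ≤_) (sym (length-trace τ)) p)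

  shapeOf-traced : ∀ ρ → Linked Step ρ → ρ ≢ [] → Valid (shapeOf ρ) × ρ ≡ trace (shapeOf ρ)
  shapeOf-traced ρ l ne with trace-shape ρ l ne
  ... | τ , v , e = subst Valid (sym τ≡) v , trans e (cong trace (sym τ≡))
    where
      τ≡ : shapeOf ρ ≡ τ
      τ≡ = trans (cong shapeOf e) (shapeOf-trace τ v)

  takeˢ-1 : ∀ τ s ys → Valid τ → trace τ ≡ s ∷ ys → takeˢ τ 1 ≡ shapeOf (s ∷ [])
  takeˢ-1 τ s ys v e = trans (sym (shapeOf-trace (takeˢ τ 1) (Valid-takeˢ τ v ≤-refl (proj₁ v))))
    (cong shapeOf (sym (proj₁ (trace-split τ (s ∷ []) ys v (sym e)))))

  first-state : ∀ τ s → Valid τ → takeˢ τ 1 ≡ shapeOf (s ∷ []) → trace τ ≡ s ∷ trace (dropˢ τ 1)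
  first-state τ s v e = trans (trace-++ τ 1 v (proj₁ v))
    (cong (_++ trace (dropˢ τ 1)) (trans (cong trace e) (sym (proj₂ (shapeOf-traced (s ∷ []) [-] (λ ()))))))

  toℕ-last : ∀ x xs → toℕ (List⁺.last (x List⁺.∷ xs)) ≡ lastIndex (x ∷ xs)
  toℕ-last x xs with initLast xs
  ... | [] = refl
  ... | ys ∷ʳ′ y = sym (lastIndex-∷ʳ (x ∷ ys) y)

  lastIndex-trace⇒1≤m : ∀ τ → Valid τ → lastIndex (trace τ) ≡ suc cap → 1 ≤ m τ
  lastIndex-trace⇒1≤m (shape k f (suc m)) _ _ = s≤s z≤n
  lastIndex-trace⇒1≤m (shape k f zero) (1≤size , _ , _) e =
    ⊥-elim (1+n≰n (subst (_≤ cap) (trans (sym (lastIndex-run t (k + 0) 1≤size)) e)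
        (≤-trans (m⊓n≤m t (suc cap)) t≤cap)))
    where
      t = (cap ∸ f) + 0
      t≤cap : t ≤ cap
      t≤cap = subst (_≤ cap) (sym (+-identityʳ (cap ∸ f))) (m∸n≤m cap f)

  1≤m⇒lastIndex-trace : ∀ τ → Valid τ → 1 ≤ m τ → lastIndex (trace τ) ≡ suc cap
  1≤m⇒lastIndex-trace (shape k f zero) _ ()
  1≤m⇒lastIndex-trace (shape k f (suc m)) (1≤size , _ , vm) _ with vm (s≤s z≤n)
  ... | refl = trans (lastIndex-run (cap + suc m) (k + suc m) 1≤size)
                     (m≥n⇒m⊓n≡n (subst (suc cap ≤_) (sym (+-suc cap m)) (s≤s (m≤m+n cap m))))


module BoundedMorphism {n : ℕ} (K K' : Kripke n) (F : Kripke.S K → Kripke.S K') where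
  private
    module A = Kripke K
    module B = Kripke K'
    module SA = StSem K
    module SB = StSem K'

  record IsBoundedMorphism : Set where
    field
      label⁺ : ∀ s p → p ∈ A.μ s → p ∈ B.μ (F s)
      label⁻ : ∀ s p → p ∈ B.μ (F s) → p ∈ A.μ s
      step⁺ : ∀ {s t} → A.δ s t → B.δ (F s) (F t)
      forth : ∀ s t' → B.δ (F s) t' → Σ A.S λ t → F t ≡ t' × A.δ s t
      back : ∀ t s' → B.δ s' (F t) → Σ A.S λ s → F s ≡ s' × A.δ s t

  module _ (morphism : IsBoundedMorphism) where
    open IsBoundedMorphism morphism

    Linked-map : ∀ {ρ} → Linked A.δ ρ → Linked B.δ (map F ρ)
    Linked-map [] = []
    Linked-map [-] = [-]
    Linked-map (r ∷ l) = step⁺ r ∷ Linked-map l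

    lift-forth : ∀ u ρ σ' → Linked A.δ (u ∷ ρ) → Linked B.δ (map F (u ∷ ρ) ++ σ') →
      Σ (List A.S) λ σ → map F σ ≡ σ' × Linked A.δ (u ∷ ρ ++ σ)
    lift-forth u [] [] l _ = [] , refl , l
    lift-forth u [] (t' ∷ σ') _ (r ∷ l') with forth u t' r
    ... | t , refl , r₀ with lift-forth t [] σ' [-] l'
    ...   | σ , refl , l₀ = t ∷ σ , refl , r₀ ∷ l₀
    lift-forth u (u' ∷ ρ) σ' (r ∷ l) (_ ∷ l') with lift-forth u' ρ σ' l l'
    ... | σ , e , l₀ = σ , e , r ∷ l₀

    lift-back : ∀ u ρ σ' → Linked A.δ (u ∷ ρ) → Linked B.δ (σ' ++ map F (u ∷ ρ)) →
      Σ (List A.S) λ σ → map F σ ≡ σ' × Linked A.δ (σ ++ u ∷ ρ)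
    lift-back u ρ [] l _ = [] , refl , l
    lift-back u ρ (t' ∷ σ') l l' with lift-back u ρ σ' l (Linked.tail l')
    lift-back u ρ (t' ∷ _) l (r ∷ _) | [] , refl , l₀ with back u t' r
    ... | s , refl , r₀ = s ∷ [] , refl , r₀ ∷ l₀
    lift-back u ρ (t' ∷ _) l (r ∷ _) | v ∷ σ , refl , l₀ with back v t' r
    ... | s , refl , r₀ = s ∷ v ∷ σ , refl , r₀ ∷ l₀

    mutual
      sat⁺ : ∀ φ ρ → ρ ≢ [] → Linked A.δ ρ → SA.sat ρ φ → SB.sat (map F ρ) φ
      sat⁺ (prop p) ρ ne l a = Allₚ.map⁺ (All.map (λ {s} → label⁺ s p) a)
      sat⁺ (neg φ) ρ ne l s s' = s (sat⁻ φ ρ ne l s')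
      sat⁺ (and φ ψ) ρ ne l (s₁ , s₂) = sat⁺ φ ρ ne l s₁ , sat⁺ ψ ρ ne l s₂
      sat⁺ (⟨B⟩ φ) ρ ne l (α , β , refl , na , nb , s) =
        map F α , map F β , map-++ F α β , map-≢[] F α na , map-≢[] F β nb , sat⁺ φ α na (Linked-++⁻ˡ α β l) s
      sat⁺ (⟨E⟩ φ) ρ ne l (α , β , refl , na , nb , s) =
        map F α , map F β , map-++ F α β , map-≢[] F α na , map-≢[] F β nb , sat⁺ φ β nb (Linked-++⁻ʳ α β l) s
      sat⁺ (⟨B̄⟩ φ) ρ ne l (σ , nσ , lk , s) =
        map F σ , map-≢[] F σ nσ , subst (Linked B.δ) (map-++ F ρ σ) (Linked-map lk) ,
        subst (λ z → SB.sat z φ) (map-++ F ρ σ) (sat⁺ φ (ρ ++ σ) (++-≢[]ˡ ρ σ ne) lk s)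
      sat⁺ (⟨Ē⟩ φ) ρ ne l (σ , nσ , lk , s) =
        map F σ , map-≢[] F σ nσ , subst (Linked B.δ) (map-++ F σ ρ) (Linked-map lk) ,
        subst (λ z → SB.sat z φ) (map-++ F σ ρ) (sat⁺ φ (σ ++ ρ) (++-≢[]ʳ σ ρ ne) lk s)

      sat⁻ : ∀ φ ρ → ρ ≢ [] → Linked A.δ ρ → SB.sat (map F ρ) φ → SA.sat ρ φ
      sat⁻ (prop p) ρ ne l a = All.map (λ {s} → label⁻ s p) (Allₚ.map⁻ a)
      sat⁻ (neg φ) ρ ne l s s' = s (sat⁺ φ ρ ne l s')
      sat⁻ (and φ ψ) ρ ne l (s₁ , s₂) = sat⁻ φ ρ ne l s₁ , sat⁻ ψ ρ ne l s₂
      sat⁻ (⟨B⟩ φ) ρ ne l (α' , β' , e , na , nb , s) with map-++⁻ F ρ α' β' e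
      ... | α , β , refl , refl , refl =
        α , β , refl , map-≢[]⁻ F α na , map-≢[]⁻ F β nb , sat⁻ φ α (map-≢[]⁻ F α na) (Linked-++⁻ˡ α β l) s
      sat⁻ (⟨E⟩ φ) ρ ne l (α' , β' , e , na , nb , s) with map-++⁻ F ρ α' β' e
      ... | α , β , refl , refl , refl =
        α , β , refl , map-≢[]⁻ F α na , map-≢[]⁻ F β nb , sat⁻ φ β (map-≢[]⁻ F β nb) (Linked-++⁻ʳ α β l) s
      sat⁻ (⟨B̄⟩ φ) [] ne _ _ = ⊥-elim (ne refl)
      sat⁻ (⟨B̄⟩ φ) (u ∷ ρ) ne l (σ' , nσ , lk , s) with lift-forth u ρ σ' l lk
      ... | σ , refl , l₀ = σ , map-≢[]⁻ F σ nσ , l₀ ,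
        sat⁻ φ (u ∷ ρ ++ σ) (λ ()) l₀ (subst (λ z → SB.sat z φ) (sym (map-++ F (u ∷ ρ) σ)) s)
      sat⁻ (⟨Ē⟩ φ) [] ne _ _ = ⊥-elim (ne refl)
      sat⁻ (⟨Ē⟩ φ) (u ∷ ρ) ne l (σ' , nσ , lk , s) with lift-back u ρ σ' l lk
      ... | σ , refl , l₀ = σ , map-≢[]⁻ F σ nσ , l₀ ,
        sat⁻ φ (σ ++ u ∷ ρ) (++-≢[]ʳ σ (u ∷ ρ) (λ ())) l₀ (subst (λ z → SB.sat z φ) (sym (map-++ F σ (u ∷ ρ))) s)

module StateBased (N : ℕ) where
  open Chain N
  open Shapes cap

  K : Kripke 1
  K = toKripke (chain idle)

  open StSem K

  record Related (d : ℕ) (ρ ρ' : List State) : Set where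
    constructor related
    field
      threshold≤cap : threshold d ≤ cap
      τ τ' : Shape
      valid : Valid τ
      valid' : Valid τ'
      ρ≡ : ρ ≡ trace τ
      ρ'≡ : ρ' ≡ trace τ'
      similar : Similar (threshold d) τ τ'

  related-sym : ∀ {d ρ ρ'} → Related d ρ ρ' → Related d ρ' ρ
  related-sym {d} (related tl τ τ' v v' e e' sim) = related tl τ' τ v' v e' e (similar-sym (1≤threshold d) sim)

  related-atoms : ∀ {d ρ ρ'} p → Related d ρ ρ' → sat ρ (prop p) → sat ρ' (prop p)
  related-atoms {d} zero (related _ τ τ' _ v' refl refl (ek , _ , _)) a =
    k≡0⇒All-Labelled τ' v' (≈-zero (1≤threshold d) ek (All-Labelled⇒k≡0 τ a))

  open Duplicator K Related

  related-split : ∀ {d ρ ρ'} → Related (suc d) ρ ρ' → ∀ α β → ρ ≡ α ++ β → α ≢ [] → β ≢ [] → Split d α β ρ'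
  related-split {d} (related tl τ τ' v v' refl refl sim) α β eq α≢[] β≢[] =
    split (trace (takeˢ τ' j')) (trace (dropˢ τ' j')) (trace-++ τ' j' v' j'≤size)
      (trace≢[] (takeˢ τ' j') 1≤size-take') (trace≢[] (dropˢ τ' j') 1≤size-drop')
      (related T'≤cap (takeˢ τ j) (takeˢ τ' j') (Valid-takeˢ τ v 1≤j j≤size) (Valid-takeˢ τ' v' 1≤j' j'≤size)
        (proj₁ α,β≡) refl similar-takeˢ)
      (related T'≤cap (dropˢ τ j) (dropˢ τ' j') (Valid-dropˢ τ v j<size) (Valid-dropˢ τ' v' j'<size)
        (proj₂ α,β≡) refl similar-dropˢ)
    where
      j = length α
      α,β≡ = trace-split τ α β v (sym eq)
      size≡ : size τ ≡ j + length β
      size≡ = trans (sym (length-trace τ)) (trans (cong length eq) (length-++ α))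
      j≤size : j ≤ size τ
      j≤size = subst (j ≤_) (sym size≡) (m≤m+n j (length β))
      j<size : j < size τ
      j<size = subst (j <_) (sym size≡) (m<m+n j (≢[]⇒1≤length β β≢[]))
      1≤j : 1 ≤ j
      1≤j = ≢[]⇒1≤length α α≢[]
      T'≤cap : threshold d ≤ cap
      T'≤cap = ≤-trans (threshold-mono d) tl
      answer = similar-split τ τ' (1≤threshold d) ≤-refl T'≤cap sim j≤size
      open SplitAnswer answer
      1≤j' : 1 ≤ j'
      1≤j' = split-answer-pos (1≤threshold d) answer 1≤j j≤size
      j'<size : j' < size τ'
      j'<size = split-answer<size (1≤threshold d) answer j<size
      1≤size-take' : 1 ≤ size (takeˢ τ' j')
      1≤size-take' = subst (1 ≤_) (sym (size-takeˢ τ' j'≤size)) 1≤j'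
      1≤size-drop' : 1 ≤ size (dropˢ τ' j')
      1≤size-drop' = subst (1 ≤_) (sym (size-dropˢ τ' j')) (m<n⇒0<n∸m j'<size)

  related-extendʳ : ∀ {d ρ ρ'} → Related (suc d) ρ ρ' → ∀ σ → σ ≢ [] → Linked Step (ρ ++ σ) →
    Σ (List State) λ σ' → σ' ≢ [] × Linked Step (ρ' ++ σ') × Related d (ρ ++ σ) (ρ' ++ σ')
  related-extendʳ {d} (related tl τ τ' v v' refl refl sim) σ σ≢[] lk
    with trace-shape (trace τ ++ σ) lk (++-≢[]ʳ (trace τ) σ σ≢[])
  ... | τ₂ , v₂ , e₂ = dropˢ-trace , trace≢[] (dropˢ extended (size τ')) 1≤size-drop , subst (Linked Step) (sym e')
      (Linked-trace extended) ,
    related (≤-trans (threshold-mono d) tl) τ₂ extended v₂ valid e₂ e'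
      (similar-extended τ₂ τ' (1≤threshold d) (threshold-mono d) v₂ (<⇒≤ L<size) similar-prefix ext)
    where
      L = length (trace τ)
      size₂≡ : size τ₂ ≡ L + length σ
      size₂≡ = trans (sym (length-trace τ₂)) (trans (cong length (sym e₂)) (length-++ (trace τ)))
      L<size : L < size τ₂
      L<size = subst (L <_) (sym size₂≡) (m<m+n L (≢[]⇒1≤length σ σ≢[]))
      1≤L : 1 ≤ L
      1≤L = subst (1 ≤_) (sym (length-trace τ)) (proj₁ v)
      τ≡ : τ ≡ takeˢ τ₂ L
      τ≡ = trace-injective τ (takeˢ τ₂ L) v (Valid-takeˢ τ₂ v₂ 1≤L (<⇒≤ L<size))
          (proj₁ (trace-split τ₂ (trace τ) σ v₂ e₂))
      similar-prefix : Similar (threshold (suc d)) (takeˢ τ₂ L) τ'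
      similar-prefix = subst (λ z → Similar (threshold (suc d)) z τ') τ≡ sim
      ext = similar-extendʳ τ₂ τ' (1≤threshold d) ≤-refl v₂ 1≤L L<size v' similar-prefix
      open Extensionʳ ext
      dropˢ-trace = trace (dropˢ extended (size τ'))
      1≤size-drop : 1 ≤ size (dropˢ extended (size τ'))
      1≤size-drop = subst (1 ≤_) (sym (size-dropˢ extended (size τ'))) (m<n⇒0<n∸m longer)
      e' : trace τ' ++ dropˢ-trace ≡ trace extended
      e' = sym (trans (trace-++ extended (size τ') valid (<⇒≤ longer))
          (cong (λ z → trace z ++ dropˢ-trace) takeˢ-extended))

  related-extendˡ : ∀ {d ρ ρ'} → Related (suc d) ρ ρ' → ∀ σ → σ ≢ [] → Linked Step (σ ++ ρ) →
    Σ (List State) λ σ' → σ' ≢ [] × Linked Step (σ' ++ ρ') × Related d (σ ++ ρ) (σ' ++ ρ')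
  related-extendˡ {d} (related tl τ τ' v v' refl refl sim) σ σ≢[] lk
    with trace-shape (σ ++ trace τ) lk (++-≢[]ˡ σ (trace τ) σ≢[])
  ... | τ₂ , v₂ , e₂ = takeˢ-trace , trace≢[] (takeˢ extended added) 1≤size-take ,
    subst (Linked Step) (sym e') (Linked-trace extended) ,
    related (≤-trans (threshold-mono d) tl) τ₂ extended v₂ valid e₂ e'
        (similar-weaken (threshold-mono d) similar-whole)
    where
      j = length σ
      size₂≡ : size τ₂ ≡ j + size τ
      size₂≡ = trans (sym (length-trace τ₂))
          (trans (cong length (sym e₂)) (trans (length-++ σ) (cong (j +_) (length-trace τ))))
      j<size : j < size τ₂
      j<size = subst (j <_) (sym size₂≡) (m<m+n j (proj₁ v))
      τ≡ : τ ≡ dropˢ τ₂ j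
      τ≡ = trace-injective τ (dropˢ τ₂ j) v (Valid-dropˢ τ₂ v₂ j<size) (proj₂ (trace-split τ₂ σ (trace τ) v₂ e₂))
      open Extensionˡ (similar-extendˡ τ₂ τ' (1≤threshold (suc d)) v₂ (≢[]⇒1≤length σ σ≢[]) j<size v'
                         (subst (λ z → Similar (threshold (suc d)) z τ') τ≡ sim))
      takeˢ-trace = trace (takeˢ extended added)
      1≤size-take : 1 ≤ size (takeˢ extended added)
      1≤size-take = subst (1 ≤_) (sym (size-takeˢ extended (<⇒≤ added<size))) 1≤added
      e' : takeˢ-trace ++ trace τ' ≡ trace extended
      e' = sym (trans (trace-++ extended added valid (<⇒≤ added<size))
          (cong (λ z → takeˢ-trace ++ trace z) dropˢ-extended))

  strategy : Strategy
  strategy = record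
    { symmetric = related-sym
    ; atoms = related-atoms
    ; splits = related-split
    ; extendʳ = related-extendʳ
    ; extendˡ = related-extendˡ
    }

  related-start : ∀ D → threshold D + threshold D ≤ cap → ∀ xs → Linked Step (idle ∷ xs) →
    Σ (List State) λ ys → Linked Step (start ∷ ys) × Related D (start ∷ ys) (idle ∷ xs)
  related-start D h xs lk with trace-shape (idle ∷ xs) lk (λ ())
  ... | τ , v , e with idle-first τ xs v e
  ...   | 1≤k , cap<f+k with similar-start τ (1≤threshold D) h v 1≤k cap<f+k
  ...     | chainStart τ' v' 1≤k' f+k≡cap sim with start-first τ' 1≤k' f+k≡cap
  ...       | ys , e' = ys , subst (Linked Step) e' (Linked-trace τ') ,
                        related (m+m≤n⇒m≤n h) τ' τ v' v (sym e') e (similar-sym (1≤threshold D) sim)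

  rerooted : ∀ φ ρ → ρ ≢ [] → Linked Step ρ → StSem.sat (toKripke (chain start)) ρ φ → sat ρ φ
  rerooted φ ρ ρ≢[] l s = subst (λ z → sat z φ) (map-id ρ) (sat⁺ identity φ ρ ρ≢[] l s)
    where
      open BoundedMorphism (toKripke (chain start)) K (λ s → s)
      identity : IsBoundedMorphism
      identity = record
        { label⁺ = λ _ _ l → l ; label⁻ = λ _ _ l → l ; step⁺ = λ r → r
        ; forth = λ _ t r → t , refl , r ; back = λ _ s r → s , refl , r }

  st-transfer : ∀ φ → threshold (depth φ) + threshold (depth φ) ≤ cap → chain start ⊨stF φ → chain idle ⊨stF φ
  st-transfer φ h start⊨φ xs lk with related-start (depth φ) h xs lk
  ... | ys , lk' , r = sat-transfer strategy φ ≤-refl r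
                         (rerooted φ (start ∷ ys) (λ ()) lk' (start⊨φ ys lk'))


eventually-p : HS 1
eventually-p = ⟨B̄⟩ (⟨E⟩ (prop zero))

module Linear (N : ℕ) where
  open Chain N

  idle-⊭lin : ¬ (chain idle ⊨lin eventually-p)
  idle-⊭lin holds with holds idling 0
    where
      idling : LinSem.InfPath (chain idle)
      idling = record { π = λ _ → idle ; init = refl ; steps = λ _ → _ }
  ... | _ , _ , i , _ , i≤j , labelled with Labelled⇒toℕ≡suc-cap {idle} (labelled i ≤-refl i≤j)
  ... | ()

  start-⊨lin : chain start ⊨lin eventually-p
  start-⊨lin path i = j , s≤s (m≤m+n i cap) , j , s≤s z≤n , ≤-refl ,
    λ h j≤h h≤j → subst (λ h → Labelled (π h)) (≤-antisym j≤h h≤j) labelled-j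
    where
      open LinSem.InfPath path
      position : ∀ h → toℕ (π h) ≡ suc h ⊓ suc cap
      position zero = trans (cong toℕ init) (toℕ-state 1)
      position (suc h) = trans (≡ᵇ⇒≡ _ _ (subst (λ z → T (step? z (toℕ (π (suc h))))) (position h) (steps h)))
                               (cong suc (sym (suc-⊓-cap h)))
      j = suc (i + cap)
      labelled-j : Labelled (π j)
      labelled-j = toℕ≡suc-cap⇒Labelled (trans (position j) (m≥n⇒m⊓n≡n (s≤s (≤-trans (m≤n+m cap i) (n≤1+n _)))))


-- Shapes of the initial traces of the chain structure, each extended by one state at a time:
-- the computation tree is mapped onto this structure by a bounded morphism.
module Histories (N : ℕ) where
  open Chain N
  open Shapes cap

  Extends : Shape → Shape → Set
  Extends τ τ₂ = Valid τ × Valid τ₂ × suc (size τ) ≡ size τ₂ × takeˢ τ₂ (size τ) ≡ τ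

  histories : Kripke 1
  histories = record { S = Shape ; δ = Extends ; μ = λ τ → (1 ≤ᵇ m τ) ∷ [] ; s₀ = shape 0 0 0 }

  Labelledʰ : Shape → Set
  Labelledʰ τ = zero ∈ ((1 ≤ᵇ m τ) ∷ [])

  Labelledʰ⇒1≤m : ∀ τ → Labelledʰ τ → 1 ≤ m τ
  Labelledʰ⇒1≤m τ l = ≤ᵇ⇒≤ 1 _ (∈-singleton⇒T l)

  1≤m⇒Labelledʰ : ∀ τ → 1 ≤ m τ → Labelledʰ τ
  1≤m⇒Labelledʰ τ p = T⇒∈-singleton (≤⇒≤ᵇ p)

  Extends⇒∷ʳ : ∀ {τ τ₂} → Extends τ τ₂ → Σ State λ s → trace τ₂ ≡ trace τ ∷ʳ s
  Extends⇒∷ʳ {τ} {τ₂} (v , v₂ , size≡ , prefix) =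
    proj₁ single , trans (trace-++ τ₂ (size τ) v₂ (subst (size τ ≤_) size≡ (n≤1+n _)))
        (cong₂ _++_ (cong trace prefix) (proj₂ single))
    where
      single = length≡1⇒singleton (trace (dropˢ τ₂ (size τ)))
        (trans (length-trace (dropˢ τ₂ (size τ)))
            (trans (size-dropˢ τ₂ (size τ)) (trans (cong (_∸ size τ) (sym size≡)) (m+n∸n≡m 1 (size τ)))))

  ∷ʳ⇒Extends : ∀ {τ τ₂ s} → Valid τ → Valid τ₂ → trace τ₂ ≡ trace τ ∷ʳ s → Extends τ τ₂
  ∷ʳ⇒Extends {τ} {τ₂} {s} v v₂ e = v , v₂ , size≡ , sym τ≡
    where
      size≡ : suc (size τ) ≡ size τ₂
      size≡ = begin
        suc (size τ)                 ≡⟨ cong suc (sym (length-trace τ)) ⟩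
        suc (length (trace τ))       ≡⟨ +-comm 1 (length (trace τ)) ⟩
        length (trace τ) + 1         ≡⟨ sym (length-++ (trace τ)) ⟩
        length (trace τ ∷ʳ s)        ≡⟨ cong length (sym e) ⟩
        length (trace τ₂)            ≡⟨ length-trace τ₂ ⟩
        size τ₂                      ∎
        where open ≡-Reasoning
      τ≡ : τ ≡ takeˢ τ₂ (size τ)
      τ≡ = trace-injective τ (takeˢ τ₂ (size τ)) v (Valid-takeˢ τ₂ v₂ (proj₁ v) (subst (size τ ≤_) size≡ (n≤1+n _)))
        (trans (proj₁ (trace-split τ₂ (trace τ) (s ∷ []) v₂ (sym e)))
            (cong (λ z → trace (takeˢ τ₂ z)) (length-trace τ)))

  -- The last L prefixes of a history of shape τ, split into the part before them (the context)
  -- and the part they add (the window).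
  window : Shape → ℕ → List Shape
  window τ zero = []
  window τ (suc L) = takeˢ τ (size τ ∸ L) ∷ window τ L

  context windowShape : Shape → ℕ → Shape
  context τ L = takeˢ τ (size τ ∸ L)
  windowShape τ L = dropˢ τ (size τ ∸ L)

  length-window : ∀ τ L → length (window τ L) ≡ L
  length-window τ zero = refl
  length-window τ (suc L) = cong suc (length-window τ L)

  size-windowShape : ∀ τ L → L ≤ size τ → size (windowShape τ L) ≡ L
  size-windowShape τ L le = trans (size-dropˢ τ (size τ ∸ L)) (m∸[m∸n]≡n le)

  window-++ : ∀ τ L₁ L₂ → Valid τ → L₁ + L₂ ≤ size τ → window τ (L₁ + L₂) ≡ window (context τ L₂) L₁ ++ window τ L₂
  window-++ τ zero L₂ v le = refl
  window-++ τ (suc L₁) L₂ v le = cong₂ _∷_ (sym head≡) (window-++ τ L₁ L₂ v (≤-trans (n≤1+n _) le))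
    where
      J = size τ ∸ L₂
      J≤size : J ≤ size τ
      J≤size = m∸n≤m (size τ) L₂
      head≡ : takeˢ (context τ L₂) (size (context τ L₂) ∸ L₁) ≡ takeˢ τ (size τ ∸ (L₁ + L₂))
      head≡ = trans (cong (λ z → takeˢ (context τ L₂) (z ∸ L₁)) (size-takeˢ τ J≤size))
        (trans (takeˢ-takeˢ τ (m∸n≤m J L₁)) (cong (takeˢ τ) ([n∸b]∸a≡n∸[a+b] (size τ) L₁ L₂)))

  window-∷ʳ : ∀ τ L → Valid τ → suc L ≤ size τ → window τ (suc L) ≡ window (context τ 1) L ∷ʳ τ
  window-∷ʳ τ L v le = trans (cong (window τ) (+-comm 1 L))
    (trans (window-++ τ L 1 v (subst (_≤ size τ) (+-comm 1 L) le))
      (cong (λ z → window (context τ 1) L ++ (z ∷ [])) (takeˢ-size τ v)))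

  window-injective : ∀ τ τ₂ L → Valid τ → Valid τ₂ → 1 ≤ L → L ≤ size τ → L ≤ size τ₂ → window τ L ≡ window τ₂ L →
      τ ≡ τ₂
  window-injective τ τ₂ (suc L) v v₂ _ le le₂ e =
    ∷ʳ-injectiveʳ _ _ (trans (sym (window-∷ʳ τ L v le)) (trans e (window-∷ʳ τ₂ L v₂ le₂)))

  window-split : ∀ τ L α β → Valid τ → L ≤ size τ → window τ L ≡ α ++ β →
    L ≡ length α + length β × α ≡ window (context τ (length β)) (length α) × β ≡ window τ (length β)
  window-split τ L α β v le eq
      = L≡ , ++-injective-length α β _ _ (trans (sym eq) split) (sym (length-window _ (length α)))
    where
      L≡ : L ≡ length α + length β
      L≡ = trans (sym (length-window τ L)) (trans (cong length eq) (length-++ α))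
      split : window τ L ≡ window (context τ (length β)) (length α) ++ window τ (length β)
      split = trans (cong (window τ) L≡) (window-++ τ (length α) (length β) v (subst (_≤ size τ) L≡ le))

  Extends-takeˢ : ∀ τ a → Valid τ → 1 ≤ a → suc a ≤ size τ → Extends (takeˢ τ a) (takeˢ τ (suc a))
  Extends-takeˢ τ a v 1≤a le = Valid-takeˢ τ v 1≤a (≤-trans (n≤1+n a) le) , Valid-takeˢ τ v (s≤s z≤n) le ,
    trans (cong suc (size-takeˢ τ (≤-trans (n≤1+n a) le))) (sym (size-takeˢ τ le)) ,
    trans (cong (takeˢ (takeˢ τ (suc a))) (size-takeˢ τ (≤-trans (n≤1+n a) le))) (takeˢ-takeˢ τ (n≤1+n a))

  Linked-window : ∀ τ L → Valid τ → L ≤ size τ → Linked Extends (window τ L)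
  Linked-window τ zero v le = []
  Linked-window τ (suc zero) v le = [-]
  Linked-window τ (suc (suc L)) v le =
    subst (λ z → Extends (takeˢ τ (size τ ∸ suc L)) (takeˢ τ z)) (suc[n∸suc-L]≡n∸L (size τ) L (≤-trans (n≤1+n _) le))
      (Extends-takeˢ τ (size τ ∸ suc L) v (m<n⇒0<n∸m le)
        (subst (_≤ size τ) (sym (suc[n∸suc-L]≡n∸L (size τ) L (≤-trans (n≤1+n _) le))) (m∸n≤m (size τ) L)))
    ∷ Linked-window τ (suc L) v (≤-trans (n≤1+n _) le)

  Windowed : List Shape → Set
  Windowed ρ = Σ Shape λ τ → Valid τ × pred (length ρ) < size τ × ρ ≡ window τ (length ρ)

  window-shape : ∀ τ₀ ρ → Valid τ₀ → Linked Extends (τ₀ ∷ ρ) → Windowed (τ₀ ∷ ρ)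
  window-shape τ₀ [] v _ = τ₀ , v , proj₁ v , cong (_∷ []) (sym (takeˢ-size τ₀ v))
  window-shape τ₀ (τ₁ ∷ ρ) v ((_ , v₁ , size≡ , prefix) ∷ l) with window-shape τ₁ ρ v₁ l
  ... | τ , vτ , lt , e = τ , vτ , suc-length<size , cong₂ _∷_ τ₀≡ e
    where
      n = length ρ
      n' = size τ ∸ n
      τ₁≡ : τ₁ ≡ takeˢ τ n'
      τ₁≡ = proj₁ (∷-injective e)
      size-τ₀ : suc (size τ₀) ≡ n'
      size-τ₀ = trans size≡ (trans (cong size τ₁≡) (size-takeˢ τ (m∸n≤m (size τ) n)))
      suc-length<size : suc n < size τ
      suc-length<size = subst (_≤ size τ) (+-comm n 2)
        (≤-trans (+-monoʳ-≤ n (subst (2 ≤_) size-τ₀ (s≤s (proj₁ v)))) (≤-reflexive (m+[n∸m]≡n (<⇒≤ lt))))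
      τ₀≡ : τ₀ ≡ takeˢ τ (size τ ∸ suc n)
      τ₀≡ = trans (sym prefix) (trans (cong (λ z → takeˢ z (size τ₀)) τ₁≡)
        (trans (takeˢ-takeˢ τ (≤-trans (n≤1+n _) (≤-reflexive size-τ₀)))
               (cong (takeˢ τ) (suc-injective
                   (trans size-τ₀ (sym (suc[n∸suc-L]≡n∸L (size τ) n (<⇒≤ suc-length<size))))))))

  All-Labelledʰ⇒k≡0 : ∀ τ L → L ≤ size τ → 1 ≤ L → All Labelledʰ (window τ L) → k (windowShape τ L) ≡ 0
  All-Labelledʰ⇒k≡0 τ (suc L) le _ (labelled ∷ _) = k≤⇒k-dropˢ≡0 τ (size τ ∸ suc L) (≤-pred
    (subst (k τ <_) (sym (suc[n∸suc-L]≡n∸L (size τ) L le))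
        (1≤m-takeˢ⇒k< τ (size τ ∸ L) (Labelledʰ⇒1≤m (takeˢ τ (size τ ∸ L)) labelled))))

  k≡0⇒All-Labelledʰ : ∀ τ L → L ≤ size τ → k (windowShape τ L) ≡ 0 → All Labelledʰ (window τ L)
  k≡0⇒All-Labelledʰ τ zero _ _ = []
  k≡0⇒All-Labelledʰ τ (suc L) le k≡0 = 1≤m⇒Labelledʰ (takeˢ τ (size τ ∸ L)) (k<⇒1≤m-takeˢ τ (size τ ∸ L) k<)
    ∷ k≡0⇒All-Labelledʰ τ L (≤-trans (n≤1+n L) le) (k≤⇒k-dropˢ≡0 τ (size τ ∸ L) (<⇒≤ k<))
    where
      k< : k τ < size τ ∸ L
      k< = subst (k τ <_) (suc[n∸suc-L]≡n∸L (size τ) L le) (s≤s (k-dropˢ≡0⇒k≤ τ (size τ ∸ suc L) k≡0))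


  window≢[] : ∀ τ L → 1 ≤ L → window τ L ≢ []
  window≢[] τ (suc L) _ ()

  context-prefix : ∀ τ {a b} → context (context τ b) a ≡ context τ (a + b)
  context-prefix τ {a} {b} = trans (cong (λ z → takeˢ (context τ b) (z ∸ a)) (size-takeˢ τ J≤size))
    (trans (takeˢ-takeˢ τ (m∸n≤m J a)) (cong (takeˢ τ) ([n∸b]∸a≡n∸[a+b] (size τ) a b)))
    where
      J = size τ ∸ b
      J≤size : J ≤ size τ
      J≤size = m∸n≤m (size τ) b

  windowShape-prefix : ∀ τ {a b} → a + b ≤ size τ → windowShape (context τ b) a ≡ takeˢ (windowShape τ (a + b)) a
  windowShape-prefix τ {a} {b} le = begin
    dropˢ (takeˢ τ J) (size (takeˢ τ J) ∸ a) ≡⟨ cong (λ z → dropˢ (takeˢ τ J) (z ∸ a)) (size-takeˢ τ J≤size) ⟩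
    dropˢ (takeˢ τ J) (J ∸ a)                ≡⟨ dropˢ-takeˢ τ (m∸n≤m J a) ⟩
    takeˢ (dropˢ τ (J ∸ a)) (J ∸ (J ∸ a))    ≡⟨ cong₂ (λ i j → takeˢ (dropˢ τ i) j) ([n∸b]∸a≡n∸[a+b] (size τ) a b)
                                                      (m∸[m∸n]≡n (m+n≤o⇒m≤o∸n a le)) ⟩
    takeˢ (windowShape τ (a + b)) a          ∎
    where
      open ≡-Reasoning
      J = size τ ∸ b
      J≤size : J ≤ size τ
      J≤size = m∸n≤m (size τ) b

  context-suffix : ∀ τ {a b} → Valid τ → a + b ≤ size τ →
    context τ b ≡ context τ (a + b) ++ˢ takeˢ (windowShape τ (a + b)) a
  context-suffix τ {a} {b} v le = trans (cong (takeˢ τ) (sym ([n∸[a+b]]+a≡n∸b (size τ) a b le)))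
    (takeˢ-+ τ {size τ ∸ (a + b)} {a} v
        (subst (_≤ size τ) (sym ([n∸[a+b]]+a≡n∸b (size τ) a b le)) (m∸n≤m (size τ) b)))

  windowShape-suffix : ∀ τ {a b} → a + b ≤ size τ → windowShape τ b ≡ dropˢ (windowShape τ (a + b)) a
  windowShape-suffix τ {a} {b} le = trans (cong (dropˢ τ) (sym ([n∸[a+b]]+a≡n∸b (size τ) a b le)))
    (sym (dropˢ-dropˢ τ {size τ ∸ (a + b)} {a}))

  context-extendʳ : ∀ τ₂ τ {L y} → takeˢ τ₂ (size τ) ≡ τ → size τ + y ≡ size τ₂ → context τ₂ (L + y) ≡ context τ L
  context-extendʳ τ₂ τ {L} {y} prefix size≡ = trans (cong (takeˢ τ₂) (index-extendʳ size≡))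
    (trans (sym (takeˢ-takeˢ τ₂ (m∸n≤m (size τ) L)))
           (cong (λ z → takeˢ z (size τ ∸ L)) prefix))
    where
      index-extendʳ : ∀ {n₂} → size τ + y ≡ n₂ → n₂ ∸ (L + y) ≡ size τ ∸ L
      index-extendʳ refl = [m+o]∸[n+o]≡m∸n (size τ) L y

  windowShape-extendʳ : ∀ τ₂ τ {L y} → Valid τ₂ → takeˢ τ₂ (size τ) ≡ τ → size τ + y ≡ size τ₂ →
    windowShape τ₂ (L + y) ≡ windowShape τ L ++ˢ dropˢ τ₂ (size τ)
  windowShape-extendʳ τ₂ τ {L} {y} v₂ prefix size≡ = trans (cong (dropˢ τ₂) (index-extendʳ size≡))
    (trans (dropˢ-via-takeˢ τ₂ v₂ (m∸n≤m (size τ) L) (subst (size τ ≤_) size≡ (m≤m+n (size τ) y)))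
           (cong (λ z → dropˢ z (size τ ∸ L) ++ˢ dropˢ τ₂ (size τ)) prefix))
    where
      index-extendʳ : ∀ {n₂} → size τ + y ≡ n₂ → n₂ ∸ (L + y) ≡ size τ ∸ L
      index-extendʳ refl = [m+o]∸[n+o]≡m∸n (size τ) L y

  context-extendˡ : ∀ τ {L y i} → size τ ∸ (y + L) ≡ i → i ≤ size τ ∸ L → context τ (y + L) ≡ takeˢ (context τ L) i
  context-extendˡ τ e i≤ = trans (cong (takeˢ τ) e) (sym (takeˢ-takeˢ τ i≤))

  windowShape-extendˡ : ∀ τ {L y i} → Valid τ → size τ ∸ (y + L) ≡ i → i ≤ size τ ∸ L →
    windowShape τ (y + L) ≡ dropˢ (context τ L) i ++ˢ windowShape τ L
  windowShape-extendˡ τ {L} v e i≤ = trans (cong (dropˢ τ) e) (dropˢ-via-takeˢ τ v i≤ (m∸n≤m (size τ) L))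

  similar-history : ∀ {T τ τ' L L'} → 1 ≤ T → Valid τ → Valid τ' →
    Similar T (context τ L) (context τ' L') → Similar T (windowShape τ L) (windowShape τ' L') → Similar T τ τ'
  similar-history {τ = τ} {τ'} {L} {L'} h v v' sc sw =
    similar-resp (takeˢ++dropˢ τ v (m∸n≤m (size τ) L)) (takeˢ++dropˢ τ' v' (m∸n≤m (size τ') L'))
      (similar-++ˢ h sc sw (GapVanishes-dropˢ τ (size τ ∸ L) (proj₂ (proj₂ v)))
          (GapVanishes-dropˢ τ' (size τ' ∸ L') (proj₂ (proj₂ v'))))

  record WRelated (d : ℕ) (ρ ρ' : List Shape) : Set where
    constructor wrelated
    field
      threshold≤cap : threshold d ≤ cap
      τ : Shape
      L : ℕ
      τ' : Shape
      L' : ℕ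
      valid : Valid τ
      valid' : Valid τ'
      1≤L : 1 ≤ L
      L≤size : L ≤ size τ
      1≤L' : 1 ≤ L'
      L'≤size : L' ≤ size τ'
      ρ≡ : ρ ≡ window τ L
      ρ'≡ : ρ' ≡ window τ' L'
      similar-context : Similar (threshold d) (context τ L) (context τ' L')
      similar-window : Similar (threshold d) (windowShape τ L) (windowShape τ' L')

  open Duplicator histories WRelated

  wrelated-sym : ∀ {d ρ ρ'} → WRelated d ρ ρ' → WRelated d ρ' ρ
  wrelated-sym {d} (wrelated tl τ L τ' L' v v' 1≤L L≤ 1≤L' L'≤ e e' sc sw) =
    wrelated tl τ' L' τ L v' v 1≤L' L'≤ 1≤L L≤ e' e (similar-sym (1≤threshold d) sc) (similar-sym (1≤threshold d) sw)

  wrelated-atoms : ∀ {d ρ ρ'} p → WRelated d ρ ρ' → StSem.sat histories ρ (prop p) → StSem.sat histories ρ' (prop p)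
  wrelated-atoms {d} zero (wrelated _ τ L τ' L' _ _ 1≤L L≤ _ L'≤ refl refl _ (ek , _ , _)) a =
    k≡0⇒All-Labelledʰ τ' L' L'≤ (≈-zero (1≤threshold d) ek (All-Labelledʰ⇒k≡0 τ L L≤ 1≤L a))

  wrelated-cut : ∀ {d} τ τ' {a b a' b' α β α' β'} → threshold d ≤ cap → Valid τ → Valid τ' →
    a + b ≤ size τ → a' + b' ≤ size τ' → 1 ≤ a → 1 ≤ b → 1 ≤ a' → 1 ≤ b' →
    α ≡ window (context τ b) a → β ≡ window τ b → α' ≡ window (context τ' b') a' → β' ≡ window τ' b' →
    Similar (threshold d) (context τ (a + b)) (context τ' (a' + b')) →
    Similar (threshold d) (takeˢ (windowShape τ (a + b)) a) (takeˢ (windowShape τ' (a' + b')) a') →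
    Similar (threshold d) (dropˢ (windowShape τ (a + b)) a) (dropˢ (windowShape τ' (a' + b')) a') →
    WRelated d α α' × WRelated d β β'
  wrelated-cut {d} τ τ' {a} {b} {a'} {b'} tl v v' le le' 1≤a 1≤b 1≤a' 1≤b' α≡ β≡ α'≡ β'≡ sc st sd =
    wrelated tl (context τ b) a (context τ' b') a' (valid-context τ a b v le 1≤a) (valid-context τ' a' b' v' le' 1≤a')
      1≤a (a≤size-context τ a b le) 1≤a' (a≤size-context τ' a' b' le') α≡ α'≡
      (similar-resp (context-prefix τ {a} {b}) (context-prefix τ' {a'} {b'}) sc)
      (similar-resp (windowShape-prefix τ {a} {b} le) (windowShape-prefix τ' {a'} {b'} le') st) ,
    wrelated tl τ b τ' b' v v' 1≤b (m+n≤o⇒n≤o a le) 1≤b' (m+n≤o⇒n≤o a' le') β≡ β'≡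
      (similar-resp (context-suffix τ {a} {b} v le) (context-suffix τ' {a'} {b'} v' le')
        (similar-++ˢ (1≤threshold d) sc st (gap τ a b v le) (gap τ' a' b' v' le')))
      (similar-resp (windowShape-suffix τ {a} {b} le) (windowShape-suffix τ' {a'} {b'} le') sd)
    where
      a≤size-context : ∀ σ a b → a + b ≤ size σ → a ≤ size (context σ b)
      a≤size-context σ a b le = subst (a ≤_) (sym (size-takeˢ σ (m∸n≤m (size σ) b))) (m+n≤o⇒m≤o∸n a le)
      valid-context : ∀ σ a b → Valid σ → a + b ≤ size σ → 1 ≤ a → Valid (context σ b)
      valid-context σ a b v le 1≤a = Valid-takeˢ σ v (≤-trans 1≤a (m+n≤o⇒m≤o∸n a le)) (m∸n≤m (size σ) b)
      gap : ∀ σ a b → Valid σ → a + b ≤ size σ → GapVanishes (takeˢ (windowShape σ (a + b)) a)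
      gap σ a b v le = GapVanishes-takeˢ (windowShape σ (a + b))
          (GapVanishes-dropˢ σ (size σ ∸ (a + b)) (proj₂ (proj₂ v)))
        (subst (a ≤_) (sym (size-windowShape σ (a + b) le)) (m≤m+n a b))

  wrelated-split : ∀ {d ρ ρ'} → WRelated (suc d) ρ ρ' → ∀ α β → ρ ≡ α ++ β → α ≢ [] → β ≢ [] → Split d α β ρ'
  wrelated-split {d} (wrelated tl τ L τ' L' v v' _ L≤ _ L'≤ refl refl sc sw) α β eq α≢[] β≢[]
    with window-split τ L α β v L≤ eq
  ... | refl , α≡ , β≡ = split (window (context τ' b') i') (window τ' b') ρ'≡ (window≢[] _ i' 1≤i')
      (window≢[] τ' b' 1≤b')
    (proj₁ cut) (proj₂ cut)
    where
      a = length α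
      b = length β
      1≤a = ≢[]⇒1≤length α α≢[]
      1≤b = ≢[]⇒1≤length β β≢[]
      T≤cap = ≤-trans (threshold-mono d) tl
      size-window : size (windowShape τ (a + b)) ≡ a + b
      size-window = size-windowShape τ (a + b) L≤
      a<size : a < size (windowShape τ (a + b))
      a<size = subst (a <_) (sym size-window) (m<m+n a 1≤b)
      answer = similar-split (windowShape τ (a + b)) (windowShape τ' L') (1≤threshold d) ≤-refl T≤cap sw (<⇒≤ a<size)
      open SplitAnswer answer renaming (j' to i'; j'≤size to i'≤size)
      i'≤L' : i' ≤ L'
      i'≤L' = subst (i' ≤_) (size-windowShape τ' L' L'≤) i'≤size
      b' = L' ∸ i'
      L'≡ : L' ≡ i' + b'
      L'≡ = sym (m+[n∸m]≡n i'≤L')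
      1≤i' : 1 ≤ i'
      1≤i' = split-answer-pos (1≤threshold d) answer 1≤a (<⇒≤ a<size)
      1≤b' : 1 ≤ b'
      1≤b' = m<n⇒0<n∸m (subst (i' <_) (size-windowShape τ' L' L'≤) (split-answer<size (1≤threshold d) answer a<size))
      ρ'≡ : window τ' L' ≡ window (context τ' b') i' ++ window τ' b'
      ρ'≡ = trans (cong (window τ') L'≡) (window-++ τ' i' b' v' (subst (_≤ size τ') L'≡ L'≤))
      cut = wrelated-cut τ τ' T≤cap v v' L≤ (subst (_≤ size τ') L'≡ L'≤) 1≤a 1≤b 1≤i' 1≤b' α≡ β≡ refl refl
        (subst (λ z → Similar _ (context τ (a + b)) (context τ' z)) L'≡ (similar-weaken (threshold-mono d) sc))
        (subst (λ z → Similar _ (takeˢ (windowShape τ (a + b)) a) (takeˢ (windowShape τ' z) i')) L'≡ similar-takeˢ)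
        (subst (λ z → Similar _ (dropˢ (windowShape τ (a + b)) a) (dropˢ (windowShape τ' z) i')) L'≡ similar-dropˢ)

  record Extendedʳ (τ : Shape) (L : ℕ) (σ : List Shape) : Set where
    constructor extendedʳ
    field
      τ₂ : Shape
      valid₂ : Valid τ₂
      prefix : takeˢ τ₂ (size τ) ≡ τ
      size≡ : size τ + length σ ≡ size τ₂
      window≡ : window τ L ++ σ ≡ window τ₂ (L + length σ)

  Extendedʳ-bound : ∀ {τ L σ} → L ≤ size τ → (e : Extendedʳ τ L σ) → L + length σ ≤ size (Extendedʳ.τ₂ e)
  Extendedʳ-bound {L = L} {σ} L≤ (extendedʳ _ _ _ size≡ _) = subst (L + length σ ≤_) size≡ (+-monoˡ-≤ (length σ) L≤)

  window-extendʳ : ∀ τ L σ → Valid τ → 1 ≤ L → L ≤ size τ → Linked Extends (window τ L ++ σ) → Extendedʳ τ L σ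
  window-extendʳ τ (suc L₀) σ v _ L≤ lk
    with window-shape (context τ L₀) (window τ L₀ ++ σ) (Valid-takeˢ τ v (m<n⇒0<n∸m L≤) (m∸n≤m (size τ) L₀)) lk
  ... | τ₂ , v₂ , lt , e₂ = extendedʳ τ₂ v₂ (trans (cong (takeˢ τ₂) size-τ) (sym τ≡))
    (trans (cong (_+ y) size-τ) (m∸n+n≡m (m+n≤o⇒n≤o L L+y≤))) window≡
    where
      L = suc L₀
      y = length σ
      length≡ : length (window τ L₀ ++ σ) ≡ L₀ + y
      length≡ = trans (length-++ (window τ L₀)) (cong (_+ y) (length-window τ L₀))
      window≡ : window τ L ++ σ ≡ window τ₂ (L + y)
      window≡ = trans e₂ (cong (λ z → window τ₂ (suc z)) length≡)
      L+y≤ : L + y ≤ size τ₂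
      L+y≤ = subst (_< size τ₂) length≡ lt
      L≤size-context : L ≤ size (context τ₂ y)
      L≤size-context = subst (L ≤_) (sym (size-takeˢ τ₂ (m∸n≤m (size τ₂) y))) (m+n≤o⇒m≤o∸n L L+y≤)
      windows≡ : window τ L ≡ window (context τ₂ y) L
      windows≡ = proj₁ (++-injective-length (window τ L) σ (window (context τ₂ y) L) (window τ₂ y)
        (trans window≡ (window-++ τ₂ L y v₂ L+y≤)) (trans (length-window τ L) (sym (length-window _ L))))
      τ≡ : τ ≡ context τ₂ y
      τ≡ = window-injective τ (context τ₂ y) L v
        (Valid-takeˢ τ₂ v₂ (≤-trans (s≤s z≤n) (m+n≤o⇒m≤o∸n L L+y≤)) (m∸n≤m (size τ₂) y))
            (s≤s z≤n) L≤ L≤size-context windows≡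
      size-τ : size τ ≡ size τ₂ ∸ y
      size-τ = trans (cong size τ≡) (size-takeˢ τ₂ (m∸n≤m (size τ₂) y))

  extendedʳ-window : ∀ τ' L' τ₂' → Valid τ₂' → L' ≤ size τ' → size τ' ≤ size τ₂' → takeˢ τ₂' (size τ') ≡ τ' →
    Extendedʳ τ' L' (window τ₂' (size τ₂' ∸ size τ'))
  extendedʳ-window τ' L' τ₂' v₂' L'≤ le prefix = extendedʳ τ₂' v₂' prefix
    (trans (cong (size τ' +_) (length-window τ₂' y')) (m+[n∸m]≡n le))
    (sym (trans (cong (λ z → window τ₂' (L' + z)) (length-window τ₂' y'))
      (trans (window-++ τ₂' L' y' v₂' (≤-trans (+-monoˡ-≤ y' L'≤) (≤-reflexive (m+[n∸m]≡n le))))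
             (cong (λ z → window z L' ++ window τ₂' y') (trans (cong (takeˢ τ₂') (m∸[m∸n]≡n le)) prefix)))))
    where
      y' = size τ₂' ∸ size τ'

  wrelated-extended : ∀ {d τ L τ' L' σ σ'} → threshold d ≤ cap → 1 ≤ L → L ≤ size τ → 1 ≤ L' → L' ≤ size τ' →
    Similar (threshold d) (context τ L) (context τ' L') →
        Similar (threshold d) (windowShape τ L) (windowShape τ' L') →
    (e : Extendedʳ τ L σ) (e' : Extendedʳ τ' L' σ') →
    Similar (threshold d) (dropˢ (Extendedʳ.τ₂ e) (size τ)) (dropˢ (Extendedʳ.τ₂ e') (size τ')) →
    WRelated d (window τ L ++ σ) (window τ' L' ++ σ')
  wrelated-extended {d} {τ} {L} {τ'} {L'} {σ} {σ'} tl 1≤L L≤ 1≤L' L'≤ sc sw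
    e@(extendedʳ τ₂ v₂ prefix size≡ window≡) e'@(extendedʳ τ₂' v₂' prefix' size≡' window≡') sa =
    wrelated tl τ₂ (L + length σ) τ₂' (L' + length σ') v₂ v₂' (≤-trans 1≤L (m≤m+n L _)) (Extendedʳ-bound L≤ e)
      (≤-trans 1≤L' (m≤m+n L' _)) (Extendedʳ-bound L'≤ e') window≡ window≡'
      (similar-resp (context-extendʳ τ₂ τ {L} {length σ} prefix size≡)
          (context-extendʳ τ₂' τ' {L'} {length σ'} prefix' size≡') sc)
      (similar-resp (windowShape-extendʳ τ₂ τ {L} {length σ} v₂ prefix size≡)
          (windowShape-extendʳ τ₂' τ' {L'} {length σ'} v₂' prefix' size≡')
        (similar-++ˢ (1≤threshold d) sw sa (GapVanishes-dropˢ τ₂ (size τ) (proj₂ (proj₂ v₂)))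
            (GapVanishes-dropˢ τ₂' (size τ') (proj₂ (proj₂ v₂')))))

  wrelated-extendʳ : ∀ {d ρ ρ'} → WRelated (suc d) ρ ρ' → ∀ σ → σ ≢ [] → Linked Extends (ρ ++ σ) →
    Σ (List Shape) λ σ' → σ' ≢ [] × Linked Extends (ρ' ++ σ') × WRelated d (ρ ++ σ) (ρ' ++ σ')
  wrelated-extendʳ {d} (wrelated tl τ L τ' L' v v' 1≤L L≤ 1≤L' L'≤ refl refl sc sw) σ σ≢[] lk =
    window extended y' , window≢[] extended y' (m<n⇒0<n∸m longer) ,
    subst (Linked Extends) (sym (Extendedʳ.window≡ e')) (Linked-window extended _ valid (Extendedʳ-bound L'≤ e')) ,
    wrelated-extended (≤-trans (threshold-mono d) tl) 1≤L L≤ 1≤L' L'≤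
      (similar-weaken (threshold-mono d) sc) (similar-weaken (threshold-mono d) sw) e e' similar-added
    where
      e = window-extendʳ τ L σ v 1≤L L≤ lk
      open Extendedʳ e using (τ₂; valid₂; prefix; size≡)
      size<size₂ : size τ < size τ₂
      size<size₂ = subst (size τ <_) size≡ (m<m+n (size τ) (≢[]⇒1≤length σ σ≢[]))
      open Extensionʳ (similar-extendʳ τ₂ τ' (1≤threshold d) ≤-refl valid₂ (proj₁ v) size<size₂ v'
        (subst (λ z → Similar (threshold (suc d)) z τ') (sym prefix)
            (similar-history {L = L} {L'} (1≤threshold (suc d)) v v' sc sw)))
      y' = size extended ∸ size τ'
      e' = extendedʳ-window τ' L' extended valid L'≤ (<⇒≤ longer) takeˢ-extended

  Linked-valid-head : ∀ τ₀ ρ → ρ ≢ [] → Linked Extends (τ₀ ∷ ρ) → Valid τ₀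
  Linked-valid-head τ₀ [] ne _ = ⊥-elim (ne refl)
  Linked-valid-head τ₀ (_ ∷ _) _ (r ∷ _) = proj₁ r

  window-extendˡ : ∀ τ L σ → Valid τ → 1 ≤ L → L ≤ size τ → σ ≢ [] → Linked Extends (σ ++ window τ L) →
    σ ++ window τ L ≡ window τ (length σ + L) × length σ + L ≤ size τ
  window-extendˡ τ L [] _ _ _ σ≢[] _ = ⊥-elim (σ≢[] refl)
  window-extendˡ τ L (τ₀ ∷ σ) v 1≤L L≤ _ lk
    with window-shape τ₀ (σ ++ window τ L) (Linked-valid-head τ₀ _ (++-≢[]ʳ σ (window τ L) (window≢[] τ L 1≤L)) lk) lk
  ... | τ₂ , v₂ , lt , e₂ = subst (λ z → (τ₀ ∷ σ) ++ window τ L ≡ window z (y + L)) (sym τ≡) window≡ ,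
                            subst (λ z → y + L ≤ size z) (sym τ≡) y+L≤
    where
      y = length (τ₀ ∷ σ)
      length≡ : length (σ ++ window τ L) ≡ length σ + L
      length≡ = trans (length-++ σ) (cong (length σ +_) (length-window τ L))
      window≡ : (τ₀ ∷ σ) ++ window τ L ≡ window τ₂ (y + L)
      window≡ = trans e₂ (cong (λ z → window τ₂ (suc z)) length≡)
      y+L≤ : y + L ≤ size τ₂
      y+L≤ = subst (_< size τ₂) length≡ lt
      windows≡ : window τ L ≡ window τ₂ L
      windows≡ = proj₂ (++-injective-length (τ₀ ∷ σ) (window τ L) (window (context τ₂ L) y) (window τ₂ L)
        (trans window≡ (window-++ τ₂ y L v₂ y+L≤)) (sym (length-window _ y)))
      τ≡ : τ ≡ τ₂
      τ≡ = window-injective τ τ₂ L v v₂ 1≤L L≤ (m+n≤o⇒n≤o y y+L≤) windows≡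

  wrelated-extendˡ : ∀ {d ρ ρ'} → WRelated (suc d) ρ ρ' → ∀ σ → σ ≢ [] → Linked Extends (σ ++ ρ) →
    Σ (List Shape) λ σ' → σ' ≢ [] × Linked Extends (σ' ++ ρ') × WRelated d (σ ++ ρ) (σ' ++ ρ')
  wrelated-extendˡ {d} (wrelated tl τ L τ' L' v v' 1≤L L≤ 1≤L' L'≤ refl refl sc sw) σ σ≢[] lk =
    window (context τ' L') y' , window≢[] _ y' 1≤y' , subst (Linked Extends) (sym σ'≡)
        (Linked-window τ' (y' + L') v' y'+L'≤) ,
    wrelated (≤-trans (threshold-mono d) tl) τ (y + L) τ' (y' + L') v v' (≤-trans 1≤L (m≤n+m L y)) y+L≤
      (≤-trans 1≤L' (m≤n+m L' y')) y'+L'≤ σ≡ σ'≡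
      (similar-resp (context-extendˡ τ {L} {y} i≡ i≤j) (context-extendˡ τ' {L'} {y'} i'≡ i'≤j') similar-takeˢ)
      (similar-resp (windowShape-extendˡ τ {L} {y} v i≡ i≤j) (windowShape-extendˡ τ' {L'} {y'} v' i'≡ i'≤j')
        (similar-++ˢ (1≤threshold d) similar-dropˢ (similar-weaken (threshold-mono d) sw)
          (GapVanishes-dropˢ τ (size τ ∸ L) (proj₂ (proj₂ v)))
              (GapVanishes-dropˢ τ' (size τ' ∸ L') (proj₂ (proj₂ v')))))
    where
      y = length σ
      σ≡ = proj₁ (window-extendˡ τ L σ v 1≤L L≤ σ≢[] lk)
      y+L≤ = proj₂ (window-extendˡ τ L σ v 1≤L L≤ σ≢[] lk)
      j = size τ ∸ L
      j' = size τ' ∸ L'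
      y≤j : y ≤ j
      y≤j = m+n≤o⇒m≤o∸n y y+L≤
      i≤j : j ∸ y ≤ j
      i≤j = m∸n≤m j y
      i≡ : size τ ∸ (y + L) ≡ j ∸ y
      i≡ = sym ([n∸b]∸a≡n∸[a+b] (size τ) y L)
      size-context : ∀ τ₀ {L} → L ≤ size τ₀ → size (context τ₀ L) ≡ size τ₀ ∸ L
      size-context τ₀ {L} L≤ = size-takeˢ τ₀ (m∸n≤m (size τ₀) L)
      i<size : j ∸ y < size (context τ L)
      i<size = subst (j ∸ y <_) (sym (size-context τ L≤)) (∸-monoʳ-< {j} {y} {0} (≢[]⇒1≤length σ σ≢[]) y≤j)
      answer = similar-split (context τ L) (context τ' L') (1≤threshold d) ≤-refl (≤-trans (threshold-mono d) tl) sc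
        (<⇒≤ i<size)
      open SplitAnswer answer renaming (j' to i'; j'≤size to i'≤size)
      i'≤j' : i' ≤ j'
      i'≤j' = subst (i' ≤_) (size-context τ' L'≤) i'≤size
      y' = j' ∸ i'
      i'≡ : size τ' ∸ (y' + L') ≡ i'
      i'≡ = trans (sym ([n∸b]∸a≡n∸[a+b] (size τ') y' L')) (m∸[m∸n]≡n i'≤j')
      1≤y' : 1 ≤ y'
      1≤y' = m<n⇒0<n∸m (subst (i' <_) (size-context τ' L'≤) (split-answer<size (1≤threshold d) answer i<size))
      y'+L'≤ : y' + L' ≤ size τ'
      y'+L'≤ = ≤-trans (+-monoˡ-≤ L' (m∸n≤m j' i')) (≤-reflexive (m∸n+n≡m L'≤))
      σ'≡ : window (context τ' L') y' ++ window τ' L' ≡ window τ' (y' + L')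
      σ'≡ = sym (window-++ τ' y' L' v' y'+L'≤)

  wstrategy : Strategy
  wstrategy = record
    { symmetric = wrelated-sym
    ; atoms = wrelated-atoms
    ; splits = wrelated-split
    ; extendʳ = wrelated-extendʳ
    ; extendˡ = wrelated-extendˡ
    }

  wrelated-full : ∀ {d τ τ'} → threshold d ≤ cap → Valid τ → Valid τ' → Similar (threshold d) τ τ' →
    WRelated d (window τ (size τ)) (window τ' (size τ'))
  wrelated-full {d} {τ} {τ'} tl v v' similar
      = wrelated tl τ (size τ) τ' (size τ') v v' (proj₁ v) ≤-refl (proj₁ v') ≤-refl refl refl
    (similar-resp (cong (takeˢ τ) (n∸n≡0 (size τ))) (cong (takeˢ τ') (n∸n≡0 (size τ'))) (similar-takeˢ-0 τ τ'))
    (similar-resp (trans (cong (dropˢ τ) (n∸n≡0 (size τ))) (dropˢ-0 τ))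
        (trans (cong (dropˢ τ') (n∸n≡0 (size τ'))) (dropˢ-0 τ')) similar)

module ComputationTree (N : ℕ) where
  open Chain N
  open Shapes cap
  open Histories N

  module Rooted (s₀ : State) where
    open CT (chain s₀)

    shapeᶜ : CState → Shape
    shapeᶜ (xs , _) = shapeOf (s₀ ∷ xs)

    open BoundedMorphism C histories shapeᶜ public

    root : CState
    root = [] , [-]

    traced : ∀ w → Valid (shapeᶜ w) × s₀ ∷ proj₁ w ≡ trace (shapeᶜ w)
    traced (xs , p) = shapeOf-traced (s₀ ∷ xs) p (λ ())

    lastIndex≡ : ∀ w → toℕ (lst w) ≡ lastIndex (trace (shapeᶜ w))
    lastIndex≡ (xs , p) = trans (toℕ-last s₀ xs) (cong lastIndex (proj₂ (traced (xs , p))))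

    step⁺ᶜ : ∀ {w w'} → CTrans w w' → Extends (shapeᶜ w) (shapeᶜ w')
    step⁺ᶜ {xs , p} {_ , p'} (s , refl , _) = ∷ʳ⇒Extends (proj₁ (traced (xs , p))) (proj₁ (traced (xs ∷ʳ s , p')))
      (trans (sym (proj₂ (traced (xs ∷ʳ s , p')))) (cong (_∷ʳ s) (proj₂ (traced (xs , p)))))

    forthᶜ : ∀ w τ₂ → Extends (shapeᶜ w) τ₂ → Σ CState λ w' → shapeᶜ w' ≡ τ₂ × CTrans w w'
    forthᶜ (xs , p) τ₂ extends
        = (xs ∷ʳ s , p') , trans (cong shapeOf (sym trace≡)) (shapeOf-trace τ₂ (proj₁ (proj₂ extends))) ,
      s , refl , Linked-∷ʳ⁻ s₀ xs s p'
      where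
        s = proj₁ (Extends⇒∷ʳ extends)
        trace≡ : trace τ₂ ≡ (s₀ ∷ xs) ∷ʳ s
        trace≡ = trans (proj₂ (Extends⇒∷ʳ extends)) (cong (_∷ʳ s) (sym (proj₂ (traced (xs , p)))))
        p' : Linked Step (s₀ ∷ xs ∷ʳ s)
        p' = subst (Linked Step) trace≡ (Linked-trace τ₂)

    backᶜ : ∀ w τ₀ → Extends τ₀ (shapeᶜ w) → Σ CState λ w₀ → shapeᶜ w₀ ≡ τ₀ × CTrans w₀ w
    backᶜ (xs , p) τ₀ extends = (ys , Linked-++⁻ˡ (s₀ ∷ ys) (s ∷ []) p') ,
      trans (cong shapeOf (sym trace₀≡)) (shapeOf-trace τ₀ (proj₁ extends)) , s , xs≡ , Linked-∷ʳ⁻ s₀ ys s p'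
      where
        s = proj₁ (Extends⇒∷ʳ extends)
        split = ∷≡∷ʳ⁻ (trans (proj₂ (traced (xs , p))) (proj₂ (Extends⇒∷ʳ extends)))
            (trace≢[] τ₀ (proj₁ (proj₁ extends)))
        ys = proj₁ split
        trace₀≡ : trace τ₀ ≡ s₀ ∷ ys
        trace₀≡ = proj₁ (proj₂ split)
        xs≡ : xs ≡ ys ∷ʳ s
        xs≡ = proj₂ (proj₂ split)
        p' : Linked Step (s₀ ∷ ys ∷ʳ s)
        p' = subst (λ z → Linked Step (s₀ ∷ z)) xs≡ p

    morphism : IsBoundedMorphism
    morphism = record
      { label⁺ = λ { w zero l → 1≤m⇒Labelledʰ (shapeᶜ w) (lastIndex-trace⇒1≤m (shapeᶜ w) (proj₁ (traced w))
                                  (trans (sym (lastIndex≡ w)) (Labelled⇒toℕ≡suc-cap {lst w} l))) }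
      ; label⁻ = λ { w zero l → toℕ≡suc-cap⇒Labelled {lst w} (trans (lastIndex≡ w)
                                  (1≤m⇒lastIndex-trace (shapeᶜ w) (proj₁ (traced w)) (Labelledʰ⇒1≤m (shapeᶜ w) l))) }
      ; step⁺ = λ {w} {w'} → step⁺ᶜ {w} {w'}
      ; forth = forthᶜ
      ; back = backᶜ
      }

  module Idle = Rooted idle
  module Start = Rooted start

  record IdleHistory (xs : List (CT.CState (chain idle))) : Set where
    constructor idleHistory
    field
      τ : Shape
      τ-valid : Valid τ
      τ-unlabelled : 1 ≤ k τ
      τ-idle : cap < f τ + k τ
      image≡ : map Idle.shapeᶜ (Idle.root ∷ xs) ≡ window τ (size τ)

  idle-history : ∀ xs → Linked (CT.CTrans (chain idle)) (Idle.root ∷ xs) → IdleHistory xs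
  idle-history xs lk
    with window-shape (Idle.shapeᶜ Idle.root) (map Idle.shapeᶜ xs) (proj₁ (Idle.traced Idle.root))
        (Idle.Linked-map Idle.morphism lk)
  ... | τ , v , l<size , e = idleHistory τ v (proj₁ starts-idle) (proj₂ starts-idle)
      (trans e (cong (window τ) (sym size≡)))
    where
      l = length (map Idle.shapeᶜ xs)
      size-root : size (Idle.shapeᶜ Idle.root) ≡ 1
      size-root = trans (sym (length-trace (Idle.shapeᶜ Idle.root)))
          (cong length (sym (proj₂ (Idle.traced Idle.root))))
      root≡ : Idle.shapeᶜ Idle.root ≡ takeˢ τ (size τ ∸ l)
      root≡ = proj₁ (∷-injective e)
      size∸l≡1 : size τ ∸ l ≡ 1
      size∸l≡1 = trans (sym (size-takeˢ τ (m∸n≤m (size τ) l))) (trans (cong size (sym root≡)) size-root)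
      size≡ : size τ ≡ suc l
      size≡ = trans (sym (m∸n+n≡m (<⇒≤ l<size))) (cong (_+ l) size∸l≡1)
      starts-idle : 1 ≤ k τ × cap < f τ + k τ
      starts-idle = idle-first τ _ v (sym (first-state τ idle v (trans (cong (takeˢ τ) (sym size∸l≡1)) (sym root≡))))

  start-history : ∀ τ' → Valid τ' → 1 ≤ k τ' → f τ' + k τ' ≡ cap →
    Σ (List (CT.CState (chain start))) λ σ → Linked (CT.CTrans (chain start)) (Start.root ∷ σ) ×
      map Start.shapeᶜ (Start.root ∷ σ) ≡ window τ' (size τ')
  start-history τ' v' 1≤k f+k≡cap =
    proj₁ lifted , proj₂ (proj₂ lifted) , trans (cong (Start.shapeᶜ Start.root ∷_) (proj₁ (proj₂ lifted))) (sym full≡)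
    where
      L = size τ' ∸ 1
      size≡ : size τ' ≡ suc L
      size≡ = sym (trans (+-comm 1 L) (m∸n+n≡m (proj₁ v')))
      first = start-first τ' 1≤k f+k≡cap
      full≡ : window τ' (size τ') ≡ Start.shapeᶜ Start.root ∷ window τ' L
      full≡ = trans (cong (window τ') size≡) (cong (_∷ window τ' L)
        (trans (cong (takeˢ τ') (trans (cong (_∸ L) size≡) (m+n∸n≡m 1 L)))
            (takeˢ-1 τ' start (proj₁ first) v' (proj₂ first))))
      lifted = Start.lift-forth Start.morphism Start.root [] (window τ' L) [-]
        (subst (Linked Extends) full≡ (Linked-window τ' (size τ') v' ≤-refl))

  idle-sat : ∀ φ xs → Linked (CT.CTrans (chain idle)) (Idle.root ∷ xs) → ∀ τ →
    map Idle.shapeᶜ (Idle.root ∷ xs) ≡ window τ (size τ) →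
    StSem.sat histories (window τ (size τ)) φ → StSem.sat (CT.C (chain idle)) (Idle.root ∷ xs) φ
  idle-sat φ xs lk τ image≡ s =
    Idle.sat⁻ Idle.morphism φ (Idle.root ∷ xs) (λ ()) lk (subst (λ ρ → StSem.sat histories ρ φ) (sym image≡) s)

  start-sat : ∀ φ σ → Linked (CT.CTrans (chain start)) (Start.root ∷ σ) → ∀ τ' →
    map Start.shapeᶜ (Start.root ∷ σ) ≡ window τ' (size τ') →
    StSem.sat (CT.C (chain start)) (Start.root ∷ σ) φ → StSem.sat histories (window τ' (size τ')) φ
  start-sat φ σ lk τ' image≡ s =
    subst (λ ρ → StSem.sat histories ρ φ) image≡ (Start.sat⁺ Start.morphism φ (Start.root ∷ σ) (λ ()) lk s)

  ct-transfer : ∀ φ → threshold (depth φ) + threshold (depth φ) ≤ cap → chain start ⊨ct φ → chain idle ⊨ct φ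
  ct-transfer φ h start⊨φ xs lk = idle-sat φ xs lk τ image≡
    (Duplicator.sat-transfer histories WRelated wstrategy φ ≤-refl
      (wrelated-full (m+m≤n⇒m≤n h) valid τ-valid (similar-sym (1≤threshold (depth φ)) similar))
      (start-sat φ σ lk' started image'≡ (start⊨φ σ lk')))
    where
      open IdleHistory (idle-history xs lk)
      open ChainStart (similar-start τ (1≤threshold (depth φ)) h τ-valid τ-unlabelled τ-idle)
      history' = start-history started valid 1≤k f+k≡cap
      σ = proj₁ history'
      lk' = proj₁ (proj₂ history')
      image'≡ = proj₂ (proj₂ history')

not-expressible : ∀ {n} (ψ : HS n) (_⊨_ : FinKripke n → HS n → Set) →
  (∀ φ → Σ (FinKripke n) λ K₁ → Σ (FinKripke n) λ K₂ → K₁ ⊨lin ψ × ¬ (K₂ ⊨lin ψ) × (K₁ ⊨ φ → K₂ ⊨ φ)) →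
  ¬ (Σ (HS n) λ φ → (K : FinKripke n) → (K ⊨ φ) ⇔ (K ⊨lin ψ))
not-expressible ψ _⊨_ fooled (φ , equivalent) with fooled φ
... | K₁ , K₂ , K₁⊨ψ , K₂⊭ψ , transfer =
  K₂⊭ψ (Equivalence.to (equivalent K₂) (transfer (Equivalence.from (equivalent K₁) K₁⊨ψ)))

fooled-by-chain : (_⊨_ : FinKripke 1 → HS 1 → Set) →
  (∀ N φ → threshold (depth φ) + threshold (depth φ) ≤ suc N → Chain.chain N (Chain.start N) ⊨ φ →
      Chain.chain N (Chain.idle N) ⊨ φ) →
  ∀ φ → Σ (FinKripke 1) λ K₁ → Σ (FinKripke 1) λ K₂ →
      K₁ ⊨lin eventually-p × ¬ (K₂ ⊨lin eventually-p) × (K₁ ⊨ φ → K₂ ⊨ φ)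
fooled-by-chain _⊨_ transfer φ = chain start , chain idle , start-⊨lin , idle-⊭lin , transfer N φ (n≤1+n N)
  where
    N = threshold (depth φ) + threshold (depth φ)
    open Chain N
    open Linear N

proposition42 : Σ ℕ λ n → Σ (HS n) λ ψ →
    (¬ (Σ (HS n) λ ψ' → (K : FinKripke n) → ((K ⊨stF ψ') ⇔ (K ⊨lin ψ))))
    × (¬ (Σ (HS n) λ ψ'' → (K : FinKripke n) → ((K ⊨ct ψ'') ⇔ (K ⊨lin ψ))))
proposition42 = 1 , eventually-p ,
  not-expressible eventually-p _⊨stF_ (fooled-by-chain _⊨stF_ StateBased.st-transfer) ,
  not-expressible eventually-p _⊨ct_ (fooled-by-chain _⊨ct_ ComputationTree.ct-transfer)
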